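{- For integers $n, m \geq 0$, let $D^o_{2,1}(n, m)$ be the number of partitions of $n$ into $m$ parts $\lambda_1 \leq \cdots \leq \lambda_m$ in which the smallest part is at least $2$, $\lambda_{i+1} - \lambda_i \geq 2$ for all $i$, and $\lambda_{i+1} - \lambda_i \geq 3$ unless $\lambda_i$ and $\lambda_{i+1}$ are both odd. Then \[ \sum_{m, n \geq 0} D^o_{2,1}(n, m) q^n x^m = \sum_{n_1, n_2 \geq 0} \frac{ q^{4n_2^2 + 4n_2 + (3n_1^2 + 3n_1)/2 + 4n_2 n_1} (1 + xq^{4n_2 + 2n_1 + 2}) x^{2n_2 + n_1} }{ (q; q)_{n_1} (q^4; q^4)_{n_2} }. \]
   Context: A partition of $n$ into $m$ parts is a non-decreasing sequence of $m$ positive integers summing to $n$. For $n \geq 0$, $(a; q)_n = \prod_{j=1}^{n} (1 - a q^{j-1})$, with the empty product equal to $1$. -}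

module Defs where

open import Data.Nat as ℕ using (ℕ; zero; suc; _∸_; _%_; _≡ᵇ_; _≤ᵇ_)
open import Data.Integer as ℤ using (ℤ; +_; -_)
open import Data.Bool using (Bool; true; false; _∧_; _∨_)
open import Data.List using (List; []; _∷_; filter; length; map; concatMap; zipWith; foldr; upTo; reverse)
open import Data.List.Base using (sum)
open import Relation.Binary.PropositionalEquality using (_≡_)
open import Relation.Nullary.Decidable using (Dec; yes; no)

candidates : ℕ → ℕ → List (List ℕ)
candidates n zero    = [] ∷ []
candidates n (suc m) = concatMap (λ a → map (a ∷_) (candidates n m)) (map suc (upTo n))

odd : ℕ → Bool
odd a = (a % 2) ≡ᵇ 1

gapOK : ℕ → ℕ → Bool
gapOK a b = ((a ℕ.+ 2) ≤ᵇ b) ∧ ((odd a ∧ odd b) ∨ ((a ℕ.+ 3) ≤ᵇ b))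

gapsOK : List ℕ → Bool
gapsOK []           = true
gapsOK (a ∷ [])     = true
gapsOK (a ∷ b ∷ l)  = gapOK a b ∧ gapsOK (b ∷ l)

smallestOK : List ℕ → Bool
smallestOK []      = true
smallestOK (a ∷ _) = 2 ≤ᵇ a

sortedB : List ℕ → Bool
sortedB []          = true
sortedB (a ∷ [])    = true
sortedB (a ∷ b ∷ l) = (a ≤ᵇ b) ∧ sortedB (b ∷ l)

listSum : List ℕ → ℕ
listSum = foldr ℕ._+_ 0

isD21 : ℕ → List ℕ → Bool
isD21 n l = (listSum l ≡ᵇ n) ∧ sortedB l ∧ smallestOK l ∧ gapsOK l

isTrue : Bool → Set
isTrue b = b ≡ true

isTrue? : (b : Bool) → Dec (isTrue b)
isTrue? true  = yes _≡_.refl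
isTrue? false = no (λ ())

D21 : ℕ → ℕ → ℕ
D21 n m = length (filter (λ l → isTrue? (isD21 n l)) (candidates n m))

PS : Set
PS = ℕ → ℤ

sumTo : ℕ → (ℕ → ℤ) → ℤ
sumTo zero    f = f 0
sumTo (suc n) f = sumTo n f ℤ.+ f (suc n)

infixl 7 _*ₚ_
infixl 6 _-ₚ_
_*ₚ_ : PS → PS → PS
(f *ₚ g) n = sumTo n (λ k → f k ℤ.* g (n ∸ k))

oneₚ : PS
oneₚ zero    = + 1
oneₚ (suc _) = + 0

qpow : ℕ → PS
qpow k n = if' (k ≡ᵇ n)
  where
  if' : Bool → ℤ
  if' true  = + 1
  if' false = + 0

_-ₚ_ : PS → PS → PS
(f -ₚ g) n = f n ℤ.- g n

-- (a; q)_n with a = q^a, base q^b:  (q^a; q^b)_n = ∏_{j=1}^{n} (1 - q^a q^{b(j-1)})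
poch : ℕ → ℕ → ℕ → PS
poch a b zero    = oneₚ
poch a b (suc n) = poch a b n *ₚ (oneₚ -ₚ qpow (a ℕ.+ b ℕ.* n))

-- multiplicative inverse of a power series with constant term 1:
-- invUpTo f n = [g n, g (n-1), …, g 0] where f * g = 1
invUpTo : PS → ℕ → List ℤ
invUpTo f zero    = + 1 ∷ []
invUpTo f (suc n) = c ∷ prev
  where
  prev = invUpTo f n
  c = - foldr ℤ._+_ (+ 0) (zipWith ℤ._*_ (map (λ k → f (suc k)) (upTo (suc n))) prev)

invₚ : PS → PS
invₚ f n with invUpTo f n
... | []    = + 0
... | c ∷ _ = c

-- Bivariate series in x, q: coefficient of x^m is a q-series

BPS : Set
BPS = ℕ → PS

infixl 7 _*ᵦ_
infixl 6 _+ᵦ_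
_*ᵦ_ : BPS → BPS → BPS
(F *ᵦ G) m n = sumTo m (λ k → (F k *ₚ G (m ∸ k)) n)

_+ᵦ_ : BPS → BPS → BPS
(F +ᵦ G) m n = F m n ℤ.+ G m n

xq : ℕ → ℕ → BPS
xq i j m = if' (i ≡ᵇ m)
  where
  if' : Bool → PS
  if' true  = qpow j
  if' false = λ _ → + 0

constᵦ : PS → BPS
constᵦ f zero    = f
constᵦ (f) (suc _) = λ _ → + 0

rhsTerm : ℕ → ℕ → BPS
rhsTerm n₁ n₂ =
  xq (2 ℕ.* n₂ ℕ.+ n₁)
     (4 ℕ.* n₂ ℕ.* n₂ ℕ.+ 4 ℕ.* n₂ ℕ.+ (3 ℕ.* n₁ ℕ.* n₁ ℕ.+ 3 ℕ.* n₁) ℕ./ 2 ℕ.+ 4 ℕ.* n₂ ℕ.* n₁)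
  *ᵦ (xq 0 0 +ᵦ xq 1 (4 ℕ.* n₂ ℕ.+ 2 ℕ.* n₁ ℕ.+ 2))
  *ᵦ constᵦ (invₚ (poch 1 1 n₁ *ₚ poch 4 4 n₂))

-- coefficient of q^n x^m of  Σ_{n₁,n₂ ≥ 0} rhsTerm n₁ n₂.
-- Only terms with 2n₂ + n₁ ≤ m have a nonzero x^m coefficient, so the
-- (infinite) sum is computed exactly by summing over n₁, n₂ ≤ m.
rhsCoeff : ℕ → ℕ → ℤ
rhsCoeff n m = sumTo m (λ n₁ → sumTo m (λ n₂ → rhsTerm n₁ n₂ m n))

-- Write t n₁ n₂ for the summand q^(4n₂²+4n₂+(3n₁²+3n₁)/2+4n₂n₁) / ((q;q)_n₁ (q⁴;q⁴)_n₂) and H m for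
-- the sum of the t n₁ n₂ with n₁ + 2n₂ = m, so that the x^m-coefficient of the right-hand side is
-- H m + q^(2m) H (m - 1) (the second term absent for m = 0). The q-difference equations
--   (1 - q^(n₁+1)) t (n₁+1) n₂ = q^(3n₁+4n₂+3) t n₁ n₂,   (1 - q^(4n₂+4)) t n₁ (n₂+1) = q^(4n₁+8n₂+8) t n₁ n₂
-- give, after a telescoping induction, H m = q^(2m) H m + q^(2m+1) H (m-1) + q^(4m) H (m-1).
-- On the other side, let C a m be the generating function of the admissible partitions into m parts
-- that are all at least a. Splitting off the smallest part gives C a (m+1) = C (a+1) (m+1) + q^a C a′ m,
-- where a′ is a + 2 for odd a and a + 3 for even a, and adding 2 to every part gives
-- C (a+2) m = q^(2m) C a m. Hence C 3 obeys the recurrence of H, which determines each H m from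
-- H (m - 1), so H = C 3, and C 2 m = C 3 m + q^(2m) C 3 (m - 1) is the right-hand side.

module Submission where

open import Defs
open import Data.Bool using (Bool; true; false; _∧_; _∨_; if_then_else_)
import Data.Bool.Properties as BoolP
open import Data.Empty using (⊥-elim)
open import Data.Integer using (ℤ; +_; -_; _+_; _-_; _*_)
import Data.Integer.Properties as ℤP
open import Data.Integer.Tactic.RingSolver using (solve-∀)
open import Data.Nat.ListAction using (sum)
open import Data.List as List using (List; []; _∷_; _++_; map; concatMap; upTo; applyUpTo; zipWith; foldr)
import Data.List.Properties as ListP
open import Data.Nat as ℕ using (ℕ; zero; suc; _∸_; _≤_; _<_; z≤n; s≤s; _≤ᵇ_; _≡ᵇ_)
import Data.Nat.DivMod as ℕDM
open import Data.Nat.Divisibility using (divides)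
import Data.Nat.Properties as ℕP
import Data.Nat.Tactic.RingSolver as ℕSolver
open import Data.Product using (∃; _,_)
open import Data.Sum using (_⊎_; inj₁; inj₂)
open import Function using (_∘_; Equivalence)
open import Relation.Binary.Bundles using (Setoid)
open import Relation.Binary.PropositionalEquality
import Relation.Binary.Reasoning.Setoid as SetoidReasoning
open import Relation.Nullary using (yes; no)

sumTo-cong-≤ : ∀ n {F G : ℕ → ℤ} → (∀ k → k ≤ n → F k ≡ G k) → sumTo n F ≡ sumTo n G
sumTo-cong-≤ zero    F≡G = F≡G 0 z≤n
sumTo-cong-≤ (suc n) F≡G =
  cong₂ _+_ (sumTo-cong-≤ n (λ k k≤n → F≡G k (ℕP.m≤n⇒m≤1+n k≤n))) (F≡G (suc n) ℕP.≤-refl)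

sumTo-cong : ∀ n {F G : ℕ → ℤ} → F ≗ G → sumTo n F ≡ sumTo n G
sumTo-cong n F≗G = sumTo-cong-≤ n (λ k _ → F≗G k)

sumTo-unfoldˡ : ∀ n (F : ℕ → ℤ) → sumTo (suc n) F ≡ F 0 + sumTo n (F ∘ suc)
sumTo-unfoldˡ zero    F = refl
sumTo-unfoldˡ (suc n) F =
  trans (cong (_+ F (suc (suc n))) (sumTo-unfoldˡ n F)) (ℤP.+-assoc (F 0) _ _)

sumTo-+ : ∀ n (F G : ℕ → ℤ) → sumTo n (λ k → F k + G k) ≡ sumTo n F + sumTo n G
sumTo-+ zero    F G = refl
sumTo-+ (suc n) F G rewrite sumTo-+ n F G = interchange (sumTo n F) (sumTo n G) (F (suc n)) (G (suc n))
  where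
  interchange : ∀ a b c d → (a + b) + (c + d) ≡ (a + c) + (b + d)
  interchange = solve-∀

sumTo-neg : ∀ n (F : ℕ → ℤ) → sumTo n (λ k → - F k) ≡ - sumTo n F
sumTo-neg zero    F = refl
sumTo-neg (suc n) F rewrite sumTo-neg n F = sym (ℤP.neg-distrib-+ (sumTo n F) (F (suc n)))

sumTo-minus : ∀ n (F G : ℕ → ℤ) → sumTo n (λ k → F k - G k) ≡ sumTo n F - sumTo n G
sumTo-minus n F G = trans (sumTo-+ n F (λ k → - G k)) (cong (_+_ (sumTo n F)) (sumTo-neg n G))

sumTo-*ˡ : ∀ n c (F : ℕ → ℤ) → c * sumTo n F ≡ sumTo n (λ k → c * F k)
sumTo-*ˡ zero    c F = refl
sumTo-*ˡ (suc n) c F =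
  trans (ℤP.*-distribˡ-+ c (sumTo n F) (F (suc n))) (cong (_+ c * F (suc n)) (sumTo-*ˡ n c F))

sumTo-zero : ∀ n {F : ℕ → ℤ} → (∀ k → k ≤ n → F k ≡ + 0) → sumTo n F ≡ + 0
sumTo-zero n {F} F≡0 = trans (sumTo-cong-≤ n F≡0) (sumTo-const-zero n)
  where
  sumTo-const-zero : ∀ n → sumTo n (λ _ → + 0) ≡ + 0
  sumTo-const-zero zero    = refl
  sumTo-const-zero (suc n) = cong (_+ + 0) (sumTo-const-zero n)

sumTo-reverse : ∀ n (F : ℕ → ℤ) → sumTo n (λ k → F (n ∸ k)) ≡ sumTo n F
sumTo-reverse zero    F = refl
sumTo-reverse (suc n) F = begin
  sumTo (suc n) (λ k → F (suc n ∸ k))  ≡⟨ sumTo-unfoldˡ n (λ k → F (suc n ∸ k)) ⟩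
  F (suc n) + sumTo n (λ k → F (n ∸ k)) ≡⟨ cong (_+_ (F (suc n))) (sumTo-reverse n F) ⟩
  F (suc n) + sumTo n F               ≡⟨ ℤP.+-comm (F (suc n)) (sumTo n F) ⟩
  sumTo (suc n) F                       ∎
  where open ≡-Reasoning

sumTo-swap : ∀ N M (F : ℕ → ℕ → ℤ) →
             sumTo N (λ a → sumTo M (F a)) ≡ sumTo M (λ b → sumTo N (λ a → F a b))
sumTo-swap zero    M F = refl
sumTo-swap (suc N) M F =
  trans (cong (_+ sumTo M (F (suc N))) (sumTo-swap N M F))
        (sym (sumTo-+ M (λ b → sumTo N (λ a → F a b)) (F (suc N))))

sumTo-extend : ∀ M N (F : ℕ → ℤ) → M ≤ N → (∀ k → M < k → F k ≡ + 0) → sumTo N F ≡ sumTo M F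
sumTo-extend M zero    F z≤n F≡0 = refl
sumTo-extend M (suc N) F M≤1+N F≡0 with ℕP.m≤n⇒m<n∨m≡n M≤1+N
... | inj₂ refl         = refl
... | inj₁ (s≤s M≤N) =
  trans (cong₂ _+_ (sumTo-extend M N F M≤N F≡0) (F≡0 (suc N) (s≤s M≤N))) (ℤP.+-identityʳ _)

sumTo-single : ∀ N j (F : ℕ → ℤ) → j ≤ N → (∀ k → k ≤ N → k ≢ j → F k ≡ + 0) →
               sumTo N F ≡ F j
sumTo-single zero    zero F z≤n   F≡0 = refl
sumTo-single (suc N) j    F j≤1+N F≡0 with ℕP.m≤n⇒m<n∨m≡n j≤1+N
... | inj₁ (s≤s j≤N) =
  trans (cong₂ _+_ (sumTo-single N j F j≤N (λ k k≤N → F≡0 k (ℕP.m≤n⇒m≤1+n k≤N)))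
                     (F≡0 (suc N) ℕP.≤-refl (ℕP.>⇒≢ (s≤s j≤N))))
        (ℤP.+-identityʳ _)
... | inj₂ refl =
  trans (cong (_+ F (suc N))
              (sumTo-zero N (λ k k≤N → F≡0 k (ℕP.m≤n⇒m≤1+n k≤N) (ℕP.<⇒≢ (s≤s k≤N)))))
        (ℤP.+-identityˡ _)

module ≗-Reasoning = SetoidReasoning (ℕ →-setoid ℤ)
open Setoid (ℕ →-setoid ℤ) using () renaming (refl to ≗-refl; sym to ≗-sym; trans to ≗-trans)

infixl 6 _+ₚ_
_+ₚ_ : PS → PS → PS
(f +ₚ g) n = f n + g n

0ₚ : PS
0ₚ _ = + 0

+ₚ-cong : ∀ {f f′ g g′} → f ≗ f′ → g ≗ g′ → f +ₚ g ≗ f′ +ₚ g′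
+ₚ-cong f≗f′ g≗g′ n = cong₂ _+_ (f≗f′ n) (g≗g′ n)

-ₚ-cong : ∀ {f f′ g g′} → f ≗ f′ → g ≗ g′ → f -ₚ g ≗ f′ -ₚ g′
-ₚ-cong f≗f′ g≗g′ n = cong₂ _-_ (f≗f′ n) (g≗g′ n)

-ₚ-congʳ : ∀ f {g g′} → g ≗ g′ → f -ₚ g ≗ f -ₚ g′
-ₚ-congʳ f g≗g′ n = cong (_-_ (f n)) (g≗g′ n)

infixl 7 _·ₚ_
_·ₚ_ : ℤ → PS → PS
(c ·ₚ f) n = c * f n

tail : PS → PS
tail f = f ∘ suc

*ₚ-unfold : ∀ f g n → (f *ₚ g) (suc n) ≡ f 0 * g (suc n) + (tail f *ₚ g) n
*ₚ-unfold f g n = sumTo-unfoldˡ n (λ k → f k * g (suc n ∸ k))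

*ₚ-cong : ∀ {f f′ g g′} → f ≗ f′ → g ≗ g′ → f *ₚ g ≗ f′ *ₚ g′
*ₚ-cong f≗f′ g≗g′ n = sumTo-cong n (λ k → cong₂ _*_ (f≗f′ k) (g≗g′ (n ∸ k)))

*ₚ-congˡ : ∀ {f f′} g → f ≗ f′ → f *ₚ g ≗ f′ *ₚ g
*ₚ-congˡ g f≗f′ = *ₚ-cong {g = g} f≗f′ (λ _ → refl)

*ₚ-congʳ : ∀ f {g g′} → g ≗ g′ → f *ₚ g ≗ f *ₚ g′
*ₚ-congʳ f g≗g′ = *ₚ-cong {f = f} (λ _ → refl) g≗g′

*ₚ-comm : ∀ f g → f *ₚ g ≗ g *ₚ f
*ₚ-comm f g n = trans (sym (sumTo-reverse n _)) (sumTo-cong-≤ n λ k k≤n →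
  trans (cong (λ j → f (n ∸ k) * g j) (ℕP.m∸[m∸n]≡n k≤n)) (ℤP.*-comm (f (n ∸ k)) (g k)))

*ₚ-distribʳ-+ₚ : ∀ f g h → (f +ₚ g) *ₚ h ≗ f *ₚ h +ₚ g *ₚ h
*ₚ-distribʳ-+ₚ f g h n =
  trans (sumTo-cong n (λ k → ℤP.*-distribʳ-+ (h (n ∸ k)) (f k) (g k))) (sumTo-+ n _ _)

*ₚ-distribʳ-minusₚ : ∀ f g h → (f -ₚ g) *ₚ h ≗ f *ₚ h -ₚ g *ₚ h
*ₚ-distribʳ-minusₚ f g h n = begin
  sumTo n (λ k → (f k - g k) * h (n ∸ k))
    ≡⟨ sumTo-cong n (λ k → distrib (f k) (g k) (h (n ∸ k))) ⟩
  sumTo n (λ k → f k * h (n ∸ k) - g k * h (n ∸ k))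
    ≡⟨ sumTo-minus n _ _ ⟩
  (f *ₚ h -ₚ g *ₚ h) n ∎
  where
  open ≡-Reasoning
  distrib : ∀ a b c → (a - b) * c ≡ a * c - b * c
  distrib = solve-∀

*ₚ-·ₚ-assoc : ∀ c f g → c ·ₚ f *ₚ g ≗ c ·ₚ (f *ₚ g)
*ₚ-·ₚ-assoc c f g n =
  trans (sumTo-cong n (λ k → ℤP.*-assoc c (f k) (g (n ∸ k)))) (sym (sumTo-*ˡ n c _))

*ₚ-assoc : ∀ f g h → (f *ₚ g) *ₚ h ≗ f *ₚ (g *ₚ h)
*ₚ-assoc f g h zero    = ℤP.*-assoc (f 0) (g 0) (h 0)
*ₚ-assoc f g h (suc n) = begin
  ((f *ₚ g) *ₚ h) (suc n)
    ≡⟨ *ₚ-unfold (f *ₚ g) h n ⟩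
  f 0 * g 0 * h (suc n) + (tail (f *ₚ g) *ₚ h) n
    ≡⟨ cong (_+_ (f 0 * g 0 * h (suc n))) tail-assoc ⟩
  f 0 * g 0 * h (suc n) + (f 0 * (tail g *ₚ h) n + (tail f *ₚ (g *ₚ h)) n)
    ≡⟨ regroup (f 0) (g 0) (h (suc n)) _ _ ⟩
  f 0 * (g 0 * h (suc n) + (tail g *ₚ h) n) + (tail f *ₚ (g *ₚ h)) n
    ≡⟨ cong (λ x → f 0 * x + (tail f *ₚ (g *ₚ h)) n) (sym (*ₚ-unfold g h n)) ⟩
  f 0 * (g *ₚ h) (suc n) + (tail f *ₚ (g *ₚ h)) n
    ≡⟨ sym (*ₚ-unfold f (g *ₚ h) n) ⟩
  (f *ₚ (g *ₚ h)) (suc n) ∎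
  where
  open ≡-Reasoning
  tail-assoc : (tail (f *ₚ g) *ₚ h) n ≡ f 0 * (tail g *ₚ h) n + (tail f *ₚ (g *ₚ h)) n
  tail-assoc = begin
    (tail (f *ₚ g) *ₚ h) n                      ≡⟨ *ₚ-congˡ h (*ₚ-unfold f g) n ⟩
    ((f 0 ·ₚ tail g +ₚ tail f *ₚ g) *ₚ h) n
      ≡⟨ *ₚ-distribʳ-+ₚ (f 0 ·ₚ tail g) (tail f *ₚ g) h n ⟩
    (f 0 ·ₚ tail g *ₚ h) n + ((tail f *ₚ g) *ₚ h) n
      ≡⟨ cong₂ _+_ (*ₚ-·ₚ-assoc (f 0) (tail g) h n) (*ₚ-assoc (tail f) g h n) ⟩
    f 0 * (tail g *ₚ h) n + (tail f *ₚ (g *ₚ h)) n ∎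
  regroup : ∀ a b c x y → a * b * c + (a * x + y) ≡ a * (b * c + x) + y
  regroup = solve-∀

*ₚ-zeroˡ : ∀ f → 0ₚ *ₚ f ≗ 0ₚ
*ₚ-zeroˡ f n = sumTo-zero n (λ k _ → ℤP.*-zeroˡ (f (n ∸ k)))

*ₚ-zeroʳ : ∀ f → f *ₚ 0ₚ ≗ 0ₚ
*ₚ-zeroʳ f n = sumTo-zero n (λ k _ → ℤP.*-zeroʳ (f k))

*ₚ-identityˡ : ∀ f → oneₚ *ₚ f ≗ f
*ₚ-identityˡ f zero    = ℤP.*-identityˡ (f 0)
*ₚ-identityˡ f (suc n) = begin
  (oneₚ *ₚ f) (suc n)                 ≡⟨ *ₚ-unfold oneₚ f n ⟩
  + 1 * f (suc n) + (0ₚ *ₚ f) n       ≡⟨ cong₂ _+_ (ℤP.*-identityˡ (f (suc n))) (*ₚ-zeroˡ f n) ⟩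
  f (suc n) + + 0                     ≡⟨ ℤP.+-identityʳ _ ⟩
  f (suc n) ∎
  where open ≡-Reasoning

*ₚ-identityʳ : ∀ f → f *ₚ oneₚ ≗ f
*ₚ-identityʳ f n = trans (*ₚ-comm f oneₚ n) (*ₚ-identityˡ f n)

-- Multiplication by a power of q

shift : ℕ → PS → PS
shift zero    f         = f
shift (suc k) f zero    = + 0
shift (suc k) f (suc n) = shift k f n

shift-≤ : ∀ k f {n} → k ≤ n → shift k f n ≡ f (n ∸ k)
shift-≤ zero    f         _         = refl
shift-≤ (suc k) f {suc n} (s≤s k≤n) = shift-≤ k f k≤n

shift-< : ∀ k f {n} → n < k → shift k f n ≡ + 0
shift-< (suc k) f {zero}  _         = refl
shift-< (suc k) f {suc n} (s≤s n<k) = shift-< k f n<k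

shift-cong : ∀ k {f g} → f ≗ g → shift k f ≗ shift k g
shift-cong zero    f≗g n       = f≗g n
shift-cong (suc k) f≗g zero    = refl
shift-cong (suc k) f≗g (suc n) = shift-cong k f≗g n

shift-cong-≡ : ∀ {k l} f → k ≡ l → shift k f ≗ shift l f
shift-cong-≡ f refl _ = refl

shift-zero : ∀ k {f} → f ≗ 0ₚ → shift k f ≗ 0ₚ
shift-zero zero    f≗0 n       = f≗0 n
shift-zero (suc k) f≗0 zero    = refl
shift-zero (suc k) f≗0 (suc n) = shift-zero k f≗0 n

shift-shift : ∀ k l f → shift k (shift l f) ≗ shift (k ℕ.+ l) f
shift-shift zero    l f n       = refl
shift-shift (suc k) l f zero    = refl
shift-shift (suc k) l f (suc n) = shift-shift k l f n

shift-+ₚ : ∀ k f g → shift k (f +ₚ g) ≗ shift k f +ₚ shift k g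
shift-+ₚ zero    f g n       = refl
shift-+ₚ (suc k) f g zero    = refl
shift-+ₚ (suc k) f g (suc n) = shift-+ₚ k f g n

shift-minusₚ : ∀ k f g → shift k (f -ₚ g) ≗ shift k f -ₚ shift k g
shift-minusₚ zero    f g n       = refl
shift-minusₚ (suc k) f g zero    = refl
shift-minusₚ (suc k) f g (suc n) = shift-minusₚ k f g n

qpow-*ₚ : ∀ k f → qpow k *ₚ f ≗ shift k f
qpow-*ₚ zero    f = ≗-trans (*ₚ-congˡ f qpow0≗oneₚ) (*ₚ-identityˡ f)
  where
  qpow0≗oneₚ : qpow 0 ≗ oneₚ
  qpow0≗oneₚ zero    = refl
  qpow0≗oneₚ (suc n) = refl
qpow-*ₚ (suc k) f zero    = ℤP.*-zeroˡ (f 0)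
qpow-*ₚ (suc k) f (suc n) = trans (*ₚ-unfold (qpow (suc k)) f n) (trans (ℤP.+-identityˡ _) (qpow-*ₚ k f n))

shift-*ₚ : ∀ k f g → shift k f *ₚ g ≗ shift k (f *ₚ g)
shift-*ₚ k f g = begin
  shift k f *ₚ g          ≈⟨ *ₚ-congˡ g (≗-sym (qpow-*ₚ k f)) ⟩
  (qpow k *ₚ f) *ₚ g      ≈⟨ *ₚ-assoc (qpow k) f g ⟩
  qpow k *ₚ (f *ₚ g)      ≈⟨ qpow-*ₚ k (f *ₚ g) ⟩
  shift k (f *ₚ g) ∎
  where open ≗-Reasoning

one-qpow-*ₚ : ∀ k f → (oneₚ -ₚ qpow k) *ₚ f ≗ f -ₚ shift k f
one-qpow-*ₚ k f = ≗-trans (*ₚ-distribʳ-minusₚ oneₚ (qpow k) f) (-ₚ-cong (*ₚ-identityˡ f) (qpow-*ₚ k f))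

Σₚ : ℕ → (ℕ → PS) → PS
Σₚ N F n = sumTo N (λ b → F b n)

shift-Σₚ : ∀ k N F → shift k (Σₚ N F) ≗ Σₚ N (λ b → shift k (F b))
shift-Σₚ zero    N F n       = refl
shift-Σₚ (suc k) N F zero    = sym (sumTo-zero N (λ _ _ → refl))
shift-Σₚ (suc k) N F (suc n) = shift-Σₚ k N F n

shift-one-qpow : ∀ e k f → shift e f -ₚ shift k (shift e f) ≗ shift e (f -ₚ shift k f)
shift-one-qpow e k f = begin
  shift e f -ₚ shift k (shift e f)     ≈⟨ -ₚ-congʳ (shift e f) shift-comm ⟩
  shift e f -ₚ shift e (shift k f)     ≈⟨ ≗-sym (shift-minusₚ e f (shift k f)) ⟩
  shift e (f -ₚ shift k f) ∎
  where
  open ≗-Reasoning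
  shift-comm : shift k (shift e f) ≗ shift e (shift k f)
  shift-comm = ≗-trans (shift-shift k e f)
                 (≗-trans (shift-cong-≡ f (ℕP.+-comm k e)) (≗-sym (shift-shift e k f)))

shift-q-difference : ∀ e {k d f g} → f -ₚ shift k f ≗ shift d g →
                     shift e f -ₚ shift (e ℕ.+ k) f ≗ shift (e ℕ.+ d) g
shift-q-difference e {k} {d} {f} {g} f-qᵏf≗qᵈg = begin
  shift e f -ₚ shift (e ℕ.+ k) f      ≈⟨ (λ n → cong (_-_ (shift e f n)) (sym (shift-shift e k f n))) ⟩
  shift e f -ₚ shift e (shift k f)    ≈⟨ ≗-sym (shift-minusₚ e f (shift k f)) ⟩
  shift e (f -ₚ shift k f)            ≈⟨ shift-cong e f-qᵏf≗qᵈg ⟩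
  shift e (shift d g)                 ≈⟨ shift-shift e d g ⟩
  shift (e ℕ.+ d) g ∎
  where open ≗-Reasoning

q-difference-split : ∀ k l f → f -ₚ shift (k ℕ.+ l) f ≗ (f -ₚ shift k f) +ₚ shift k (f -ₚ shift l f)
q-difference-split k l f n rewrite shift-minusₚ k f (shift l f) n | shift-shift k l f n =
  telescope (f n) (shift k f n) (shift (k ℕ.+ l) f n)
  where
  telescope : ∀ x y z → x - z ≡ (x - y) + (y - z)
  telescope = solve-∀

-ₚ≗⇒+ₚ≗ : ∀ {f g h} → f -ₚ g ≗ h → h +ₚ g ≗ f
-ₚ≗⇒+ₚ≗ {f} {g} f-g≗h n rewrite sym (f-g≗h n) = cancel (f n) (g n)
  where
  cancel : ∀ x y → x - y + y ≡ x
  cancel = solve-∀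

shift-vanish : ∀ k f s → (∀ j → j ≤ s → f j ≡ + 0) → shift k f s ≡ + 0
shift-vanish zero    f s       f≡0 = f≡0 s ℕP.≤-refl
shift-vanish (suc k) f zero    f≡0 = refl
shift-vanish (suc k) f (suc s) f≡0 = shift-vanish k f s (λ j j≤s → f≡0 j (ℕP.m≤n⇒m≤1+n j≤s))

shift-suc-agree : ∀ k F G n → (∀ j → j < n → F j ≡ G j) → shift (suc k) F n ≡ shift (suc k) G n
shift-suc-agree k       F G zero    _     = refl
shift-suc-agree zero    F G (suc n) F≡G = F≡G n ℕP.≤-refl
shift-suc-agree (suc k) F G (suc n) F≡G = shift-suc-agree k F G n (λ j j<n → F≡G j (ℕP.m<n⇒m<1+n j<n))

-- Since q^(k+1) F only involves lower coefficients of F, F is determined by F - q^(k+1) F.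
q-difference-injective : ∀ k F G → F -ₚ shift (suc k) F ≗ G -ₚ shift (suc k) G → F ≗ G
q-difference-injective k F G same n = up-to n n ℕP.≤-refl
  where
  cancel : ∀ x y a b → x - a ≡ y - b → a ≡ b → x ≡ y
  cancel x y a b x-a≡y-b refl = trans (sym (lemma x a)) (trans (cong (_+ a) x-a≡y-b) (lemma y a))
    where
    lemma : ∀ x a → x - a + a ≡ x
    lemma = solve-∀
  up-to : ∀ n j → j ≤ n → F j ≡ G j
  up-to zero    .zero z≤n = cancel (F 0) (G 0) (shift (suc k) F 0) (shift (suc k) G 0) (same 0) refl
  up-to (suc n) j j≤1+n with ℕP.m≤n⇒m<n∨m≡n j≤1+n
  ... | inj₁ (s≤s j≤n) = up-to n j j≤n
  ... | inj₂ refl      = cancel (F (suc n)) (G (suc n)) _ _ (same (suc n))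
                                (shift-suc-agree k F G (suc n) (λ j j<1+n → up-to n j (ℕP.≤-pred j<1+n)))

recurrence⇒q-difference : ∀ {X B C} k → X ≗ shift k X +ₚ B +ₚ C → X -ₚ shift k X ≗ B +ₚ C
recurrence⇒q-difference {X} {B} {C} k X≗ n rewrite X≗ n = cancel (shift k X n) (B n) (C n)
  where
  cancel : ∀ a b c → a + b + c - a ≡ b + c
  cancel = solve-∀

coeffsDown : PS → ℕ → List ℤ
coeffsDown g zero    = g 0 ∷ []
coeffsDown g (suc n) = g (suc n) ∷ coeffsDown g n

invUpTo≡coeffsDown : ∀ f n → invUpTo f n ≡ coeffsDown (invₚ f) n
invUpTo≡coeffsDown f zero    = refl
invUpTo≡coeffsDown f (suc n) = cong (invₚ f (suc n) ∷_) (invUpTo≡coeffsDown f n)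

foldr-zipWith-coeffsDown : ∀ n (F : ℕ → ℤ) g →
  foldr _+_ (+ 0) (zipWith _*_ (applyUpTo F (suc n)) (coeffsDown g n)) ≡ sumTo n (λ k → F k * g (n ∸ k))
foldr-zipWith-coeffsDown zero    F g = ℤP.+-identityʳ _
foldr-zipWith-coeffsDown (suc n) F g =
  trans (cong (_+_ (F 0 * g (suc n))) (foldr-zipWith-coeffsDown n (F ∘ suc) g))
        (sym (sumTo-unfoldˡ n (λ k → F k * g (suc n ∸ k))))

invₚ-suc : ∀ f n → invₚ f (suc n) ≡ - (tail f *ₚ invₚ f) n
invₚ-suc f n = cong -_ (begin
  foldr _+_ (+ 0) (zipWith _*_ (map (λ k → f (suc k)) (upTo (suc n))) (invUpTo f n))
    ≡⟨ cong₂ (λ as bs → foldr _+_ (+ 0) (zipWith _*_ as bs))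
             (ListP.map-upTo (λ k → f (suc k)) (suc n)) (invUpTo≡coeffsDown f n) ⟩
  foldr _+_ (+ 0) (zipWith _*_ (applyUpTo (λ k → f (suc k)) (suc n)) (coeffsDown (invₚ f) n))
    ≡⟨ foldr-zipWith-coeffsDown n (λ k → f (suc k)) (invₚ f) ⟩
  (tail f *ₚ invₚ f) n ∎)
  where open ≡-Reasoning

invₚ-inverseʳ : ∀ f → f 0 ≡ + 1 → f *ₚ invₚ f ≗ oneₚ
invₚ-inverseʳ f f0≡1 zero    rewrite f0≡1 = refl
invₚ-inverseʳ f f0≡1 (suc n) rewrite *ₚ-unfold f (invₚ f) n | invₚ-suc f n | f0≡1 =
  cancel ((tail f *ₚ invₚ f) n)
  where
  cancel : ∀ x → + 1 * - x + x ≡ + 0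
  cancel = solve-∀

invₚ-unique : ∀ f g → f 0 ≡ + 1 → f *ₚ g ≗ oneₚ → g ≗ invₚ f
invₚ-unique f g f0≡1 fg≗1 = begin
  g                         ≈⟨ ≗-sym (*ₚ-identityˡ g) ⟩
  oneₚ *ₚ g                 ≈⟨ *ₚ-congˡ g (≗-sym (invₚ-inverseʳ f f0≡1)) ⟩
  (f *ₚ invₚ f) *ₚ g        ≈⟨ *ₚ-congˡ g (*ₚ-comm f (invₚ f)) ⟩
  (invₚ f *ₚ f) *ₚ g        ≈⟨ *ₚ-assoc (invₚ f) f g ⟩
  invₚ f *ₚ (f *ₚ g)        ≈⟨ *ₚ-congʳ (invₚ f) fg≗1 ⟩
  invₚ f *ₚ oneₚ            ≈⟨ *ₚ-identityʳ (invₚ f) ⟩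
  invₚ f ∎
  where open ≗-Reasoning

invₚ-*-one-qpow : ∀ P Q k → P 0 ≡ + 1 → Q 0 ≡ + 1 → Q ≗ P *ₚ (oneₚ -ₚ qpow k) →
                  invₚ Q -ₚ shift k (invₚ Q) ≗ invₚ P
invₚ-*-one-qpow P Q k P0≡1 Q0≡1 Q≗P[1-qᵏ] = ≗-trans (≗-sym (one-qpow-*ₚ k (invₚ Q)))
  (invₚ-unique P ((oneₚ -ₚ qpow k) *ₚ invₚ Q) P0≡1 (begin
    P *ₚ ((oneₚ -ₚ qpow k) *ₚ invₚ Q)   ≈⟨ ≗-sym (*ₚ-assoc P (oneₚ -ₚ qpow k) (invₚ Q)) ⟩
    (P *ₚ (oneₚ -ₚ qpow k)) *ₚ invₚ Q   ≈⟨ *ₚ-congˡ (invₚ Q) (≗-sym Q≗P[1-qᵏ]) ⟩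
    Q *ₚ invₚ Q                         ≈⟨ invₚ-inverseʳ Q Q0≡1 ⟩
    oneₚ ∎))
  where open ≗-Reasoning

denominator : ℕ → ℕ → PS
denominator n₁ n₂ = poch 1 1 n₁ *ₚ poch 4 4 n₂

exponent : ℕ → ℕ → ℕ
exponent n₁ n₂ =
  4 ℕ.* n₂ ℕ.* n₂ ℕ.+ 4 ℕ.* n₂ ℕ.+ (3 ℕ.* n₁ ℕ.* n₁ ℕ.+ 3 ℕ.* n₁) ℕ./ 2 ℕ.+ 4 ℕ.* n₂ ℕ.* n₁

summand : ℕ → ℕ → PS
summand n₁ n₂ = shift (exponent n₁ n₂) (invₚ (denominator n₁ n₂))

poch-constant : ∀ a b n → poch (suc a) b n 0 ≡ + 1
poch-constant a b zero    = refl
poch-constant a b (suc n) rewrite poch-constant a b n = refl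

denominator-constant : ∀ n₁ n₂ → denominator n₁ n₂ 0 ≡ + 1
denominator-constant n₁ n₂ rewrite poch-constant 0 1 n₁ | poch-constant 3 4 n₂ = refl

denominator-suc₁ : ∀ n₁ n₂ →
  denominator (suc n₁) n₂ ≗ denominator n₁ n₂ *ₚ (oneₚ -ₚ qpow (suc n₁))
denominator-suc₁ n₁ n₂ = begin
  (poch 1 1 n₁ *ₚ (oneₚ -ₚ qpow (1 ℕ.+ 1 ℕ.* n₁))) *ₚ poch 4 4 n₂
    ≈⟨ *ₚ-congˡ (poch 4 4 n₂) (*ₚ-congʳ (poch 1 1 n₁)
         (λ k → cong (λ e → (oneₚ -ₚ qpow (suc e)) k) (ℕP.*-identityˡ n₁))) ⟩
  (poch 1 1 n₁ *ₚ ω) *ₚ poch 4 4 n₂     ≈⟨ *ₚ-assoc (poch 1 1 n₁) ω (poch 4 4 n₂) ⟩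
  poch 1 1 n₁ *ₚ (ω *ₚ poch 4 4 n₂)     ≈⟨ *ₚ-congʳ (poch 1 1 n₁) (*ₚ-comm ω (poch 4 4 n₂)) ⟩
  poch 1 1 n₁ *ₚ (poch 4 4 n₂ *ₚ ω)     ≈⟨ ≗-sym (*ₚ-assoc (poch 1 1 n₁) (poch 4 4 n₂) ω) ⟩
  denominator n₁ n₂ *ₚ ω ∎
  where
  open ≗-Reasoning
  ω = oneₚ -ₚ qpow (suc n₁)

denominator-suc₂ : ∀ n₁ n₂ →
  denominator n₁ (suc n₂) ≗ denominator n₁ n₂ *ₚ (oneₚ -ₚ qpow (4 ℕ.+ 4 ℕ.* n₂))
denominator-suc₂ n₁ n₂ =
  ≗-sym (*ₚ-assoc (poch 1 1 n₁) (poch 4 4 n₂) (oneₚ -ₚ qpow (4 ℕ.+ 4 ℕ.* n₂)))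

triangular-suc : ∀ a → let T = 3 ℕ.* a ℕ.* a ℕ.+ 3 ℕ.* a in
  (3 ℕ.* suc a ℕ.* suc a ℕ.+ 3 ℕ.* suc a) ℕ./ 2 ≡ 3 ℕ.* suc a ℕ.+ T ℕ./ 2
triangular-suc a = begin
  (3 ℕ.* suc a ℕ.* suc a ℕ.+ 3 ℕ.* suc a) ℕ./ 2  ≡⟨ cong (ℕ._/ 2) (expand a) ⟩
  (T ℕ.+ 3 ℕ.* suc a ℕ.* 2) ℕ./ 2                 ≡⟨ ℕDM.+-distrib-/-∣ʳ T (divides (3 ℕ.* suc a) refl) ⟩
  T ℕ./ 2 ℕ.+ 3 ℕ.* suc a ℕ.* 2 ℕ./ 2             ≡⟨ cong (T ℕ./ 2 ℕ.+_) (ℕDM.m*n/n≡m (3 ℕ.* suc a) 2) ⟩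
  T ℕ./ 2 ℕ.+ 3 ℕ.* suc a                         ≡⟨ ℕP.+-comm (T ℕ./ 2) (3 ℕ.* suc a) ⟩
  3 ℕ.* suc a ℕ.+ T ℕ./ 2 ∎
  where
  open ≡-Reasoning
  T = 3 ℕ.* a ℕ.* a ℕ.+ 3 ℕ.* a
  expand : ∀ a → 3 ℕ.* suc a ℕ.* suc a ℕ.+ 3 ℕ.* suc a ≡
                 (3 ℕ.* a ℕ.* a ℕ.+ 3 ℕ.* a) ℕ.+ 3 ℕ.* suc a ℕ.* 2
  expand = ℕSolver.solve-∀

exponent-suc₁ : ∀ n₁ n₂ → exponent (suc n₁) n₂ ≡ (3 ℕ.* suc n₁ ℕ.+ 4 ℕ.* n₂) ℕ.+ exponent n₁ n₂
exponent-suc₁ n₁ n₂ rewrite triangular-suc n₁ =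
  regroup (3 ℕ.* suc n₁) ((3 ℕ.* n₁ ℕ.* n₁ ℕ.+ 3 ℕ.* n₁) ℕ./ 2) n₁ n₂
  where
  regroup : ∀ x w a b → 4 ℕ.* b ℕ.* b ℕ.+ 4 ℕ.* b ℕ.+ (x ℕ.+ w) ℕ.+ 4 ℕ.* b ℕ.* suc a ≡
                        (x ℕ.+ 4 ℕ.* b) ℕ.+ (4 ℕ.* b ℕ.* b ℕ.+ 4 ℕ.* b ℕ.+ w ℕ.+ 4 ℕ.* b ℕ.* a)
  regroup = ℕSolver.solve-∀

exponent-suc₂ : ∀ n₁ n₂ → exponent n₁ (suc n₂) ≡ (4 ℕ.* n₁ ℕ.+ 8 ℕ.* suc n₂) ℕ.+ exponent n₁ n₂
exponent-suc₂ n₁ n₂ = regroup ((3 ℕ.* n₁ ℕ.* n₁ ℕ.+ 3 ℕ.* n₁) ℕ./ 2) n₁ n₂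
  where
  regroup : ∀ w a b → 4 ℕ.* suc b ℕ.* suc b ℕ.+ 4 ℕ.* suc b ℕ.+ w ℕ.+ 4 ℕ.* suc b ℕ.* a ≡
                      (4 ℕ.* a ℕ.+ 8 ℕ.* suc b) ℕ.+ (4 ℕ.* b ℕ.* b ℕ.+ 4 ℕ.* b ℕ.+ w ℕ.+ 4 ℕ.* b ℕ.* a)
  regroup = ℕSolver.solve-∀

summand-q-difference : ∀ {n₁ n₂ n₁′ n₂′} k d →
  denominator n₁′ n₂′ ≗ denominator n₁ n₂ *ₚ (oneₚ -ₚ qpow k) →
  exponent n₁′ n₂′ ≡ d ℕ.+ exponent n₁ n₂ →
  summand n₁′ n₂′ -ₚ shift k (summand n₁′ n₂′) ≗ shift d (summand n₁ n₂)
summand-q-difference {n₁} {n₂} {n₁′} {n₂′} k d denominator-step exponent-step = begin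
  summand n₁′ n₂′ -ₚ shift k (summand n₁′ n₂′)   ≈⟨ shift-one-qpow (exponent n₁′ n₂′) k U′ ⟩
  shift (exponent n₁′ n₂′) (U′ -ₚ shift k U′)     ≈⟨ shift-cong (exponent n₁′ n₂′) inverse-step ⟩
  shift (exponent n₁′ n₂′) U                      ≈⟨ shift-cong-≡ U exponent-step ⟩
  shift (d ℕ.+ exponent n₁ n₂) U                  ≈⟨ ≗-sym (shift-shift d (exponent n₁ n₂) U) ⟩
  shift d (summand n₁ n₂) ∎
  where
  open ≗-Reasoning
  U = invₚ (denominator n₁ n₂)
  U′ = invₚ (denominator n₁′ n₂′)
  inverse-step : U′ -ₚ shift k U′ ≗ U
  inverse-step = invₚ-*-one-qpow _ _ k (denominator-constant n₁ n₂) (denominator-constant n₁′ n₂′)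
                                 denominator-step

summand-suc₁ : ∀ n₁ n₂ → summand (suc n₁) n₂ -ₚ shift (suc n₁) (summand (suc n₁) n₂)
                         ≗ shift (3 ℕ.* suc n₁ ℕ.+ 4 ℕ.* n₂) (summand n₁ n₂)
summand-suc₁ n₁ n₂ = summand-q-difference {n₁} {n₂} {suc n₁} {n₂}
  (suc n₁) (3 ℕ.* suc n₁ ℕ.+ 4 ℕ.* n₂) (denominator-suc₁ n₁ n₂) (exponent-suc₁ n₁ n₂)

summand-suc₂ : ∀ n₁ n₂ → summand n₁ (suc n₂) -ₚ shift (4 ℕ.+ 4 ℕ.* n₂) (summand n₁ (suc n₂))
                         ≗ shift (4 ℕ.* n₁ ℕ.+ 8 ℕ.* suc n₂) (summand n₁ n₂)
summand-suc₂ n₁ n₂ = summand-q-difference {n₁} {n₂} {n₁} {suc n₂}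
  (4 ℕ.+ 4 ℕ.* n₂) (4 ℕ.* n₁ ℕ.+ 8 ℕ.* suc n₂) (denominator-suc₂ n₁ n₂) (exponent-suc₂ n₁ n₂)

summand-0-0 : summand 0 0 ≗ oneₚ
summand-0-0 = ≗-sym (invₚ-unique (denominator 0 0) oneₚ refl
  (≗-trans (*ₚ-identityʳ (denominator 0 0)) (*ₚ-identityˡ oneₚ)))

-- The x^m-coefficient H m of the sum without the factor (1 + x q^(4n₂+2n₁+2))

term : ℕ → ℕ → PS
term m n₂ with 2 ℕ.* n₂ ℕ.≤? m
... | yes _ = summand (m ∸ 2 ℕ.* n₂) n₂
... | no  _ = 0ₚ

term-summand : ∀ {m} a b → m ≡ a ℕ.+ 2 ℕ.* b → term m b ≗ summand a b
term-summand {m} a b m≡a+2b with 2 ℕ.* b ℕ.≤? m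
... | yes _    rewrite m≡a+2b = λ n → cong (λ x → summand x b n) (ℕP.m+n∸n≡m a (2 ℕ.* b))
... | no 2b≰m = ⊥-elim (2b≰m (subst (2 ℕ.* b ≤_) (sym m≡a+2b) (ℕP.m≤n+m _ a)))

term-vanish : ∀ {m} b → m < 2 ℕ.* b → term m b ≗ 0ₚ
term-vanish {m} b m<2b with 2 ℕ.* b ℕ.≤? m
... | yes 2b≤m = ⊥-elim (ℕP.<⇒≱ m<2b 2b≤m)
... | no _     = λ _ → refl

term-beyond : ∀ {m} b → m < b → term m b ≗ 0ₚ
term-beyond b m<b = term-vanish b (ℕP.<-≤-trans m<b (ℕP.m≤m+n b _))

term-view : ∀ m b → (∃ λ a → m ≡ a ℕ.+ 2 ℕ.* b) ⊎ m < 2 ℕ.* b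
term-view m b with 2 ℕ.* b ℕ.≤? m
... | yes 2b≤m = inj₁ (m ∸ 2 ℕ.* b , sym (ℕP.m∸n+n≡m 2b≤m))
... | no 2b≰m  = inj₂ (ℕP.≰⇒> 2b≰m)

H : ℕ → PS
H m = Σₚ m (term m)

H-extend : ∀ m N → m ≤ N → Σₚ N (term m) ≗ H m
H-extend m N m≤N n = sumTo-extend m N (λ b → term m b n) m≤N (λ b m<b → term-beyond b m<b n)

H-0 : H 0 ≗ oneₚ
H-0 = ≗-trans (term-summand 0 0 refl) summand-0-0

term-suc-q-difference : ∀ M b →
  shift (4 ℕ.* suc M) (term M b) +ₚ shift (2 ℕ.* suc M) (term (suc M) b) ≗ shift (suc M ℕ.+ 2 ℕ.* b) (term (suc M) b)
term-suc-q-difference M b with term-view M b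
... | inj₁ (a , refl) = begin
  shift (4 ℕ.* m) (term M b) +ₚ shift (2 ℕ.* m) (term m b)
    ≈⟨ +ₚ-cong (shift-cong (4 ℕ.* m) (term-summand a b refl)) (shift-cong (2 ℕ.* m) (term-summand (suc a) b refl)) ⟩
  shift (4 ℕ.* m) T +ₚ shift (2 ℕ.* m) T′
    ≈⟨ -ₚ≗⇒+ₚ≗ (begin
         shift e T′ -ₚ shift (2 ℕ.* m) T′              ≈⟨ -ₚ-congʳ (shift e T′) (shift-cong-≡ T′ (sym (exponent₁ a b))) ⟩
         shift e T′ -ₚ shift (e ℕ.+ suc a) T′          ≈⟨ shift-q-difference e (summand-suc₁ a b) ⟩
         shift (e ℕ.+ (3 ℕ.* suc a ℕ.+ 4 ℕ.* b)) T     ≈⟨ shift-cong-≡ T (exponent₂ a b) ⟩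
         shift (4 ℕ.* m) T ∎) ⟩
  shift e T′
    ≈⟨ ≗-sym (shift-cong e (term-summand (suc a) b refl)) ⟩
  shift e (term m b) ∎
  where
  open ≗-Reasoning
  m = suc M
  e = m ℕ.+ 2 ℕ.* b
  T = summand a b
  T′ = summand (suc a) b
  exponent₁ : ∀ a b → suc (a ℕ.+ 2 ℕ.* b) ℕ.+ 2 ℕ.* b ℕ.+ suc a ≡ 2 ℕ.* suc (a ℕ.+ 2 ℕ.* b)
  exponent₁ = ℕSolver.solve-∀
  exponent₂ : ∀ a b → suc (a ℕ.+ 2 ℕ.* b) ℕ.+ 2 ℕ.* b ℕ.+ (3 ℕ.* suc a ℕ.+ 4 ℕ.* b) ≡ 4 ℕ.* suc (a ℕ.+ 2 ℕ.* b)
  exponent₂ = ℕSolver.solve-∀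
... | inj₂ M<2b with ℕP.m≤n⇒m<n∨m≡n M<2b
...   | inj₁ 1+M<2b = ≗-trans
  (+ₚ-cong (shift-zero (4 ℕ.* suc M) (term-vanish b M<2b)) (shift-zero (2 ℕ.* suc M) (term-vanish b 1+M<2b)))
  (≗-sym (shift-zero (suc M ℕ.+ 2 ℕ.* b) (term-vanish b 1+M<2b)))
...   | inj₂ 1+M≡2b = λ n → trans
  (cong (_+ shift (2 ℕ.* suc M) (term (suc M) b) n) (shift-zero (4 ℕ.* suc M) (term-vanish b M<2b) n))
  (trans (ℤP.+-identityˡ _) (shift-cong-≡ (term (suc M) b) (cong (suc M ℕ.+_) 1+M+0≡2b) n))
  where
  1+M+0≡2b : suc M ℕ.+ 0 ≡ 2 ℕ.* b
  1+M+0≡2b = trans (ℕP.+-identityʳ (suc M)) 1+M≡2b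

term-defect-0 : ∀ M → term (suc M) 0 -ₚ shift (suc M ℕ.+ 2 ℕ.* 0) (term (suc M) 0)
                      ≗ shift (3 ℕ.* suc M ℕ.+ 2 ℕ.* 0) (term M 0)
term-defect-0 M = begin
  term (suc M) 0 -ₚ shift (suc M ℕ.+ 0) (term (suc M) 0)
    ≈⟨ -ₚ-cong (term-summand (suc M) 0 (+0 (suc M)))
               (≗-trans (shift-cong-≡ (term (suc M) 0) (ℕP.+-identityʳ (suc M)))
                        (shift-cong (suc M) (term-summand (suc M) 0 (+0 (suc M))))) ⟩
  summand (suc M) 0 -ₚ shift (suc M) (summand (suc M) 0)
    ≈⟨ summand-suc₁ M 0 ⟩
  shift (3 ℕ.* suc M ℕ.+ 0) (summand M 0)
    ≈⟨ ≗-sym (shift-cong (3 ℕ.* suc M ℕ.+ 0) (term-summand M 0 (+0 M))) ⟩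
  shift (3 ℕ.* suc M ℕ.+ 0) (term M 0) ∎
  where
  open ≗-Reasoning
  +0 : ∀ M → M ≡ M ℕ.+ 2 ℕ.* 0
  +0 M = sym (ℕP.+-identityʳ M)

-- Splitting 1 - q^(a+4b) as (1 - q^(4b)) + q^(4b) (1 - q^a) reduces to the two q-difference equations.
summand-defect-suc : ∀ a c → let m = suc (suc (a ℕ.+ 2 ℕ.* c)) in
  summand a (suc c) -ₚ shift (m ℕ.+ 2 ℕ.* suc c) (summand a (suc c))
  ≗ shift (4 ℕ.* m) (summand a c) +ₚ shift (3 ℕ.* m ℕ.+ 2 ℕ.* suc c) (term (suc (a ℕ.+ 2 ℕ.* c)) (suc c))
summand-defect-suc a c = begin
  S -ₚ shift (m ℕ.+ 2 ℕ.* suc c) S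
    ≈⟨ -ₚ-congʳ S (shift-cong-≡ S (exponent-split a c)) ⟩
  S -ₚ shift (k ℕ.+ a) S
    ≈⟨ q-difference-split k a S ⟩
  (S -ₚ shift k S) +ₚ shift k (S -ₚ shift a S)
    ≈⟨ +ₚ-cong (≗-trans (summand-suc₂ a c) (shift-cong-≡ _ (exponent-outer a c))) (inner a refl) ⟩
  shift (4 ℕ.* m) (summand a c) +ₚ shift e (term (suc (a ℕ.+ 2 ℕ.* c)) (suc c)) ∎
  where
  open ≗-Reasoning
  m = suc (suc (a ℕ.+ 2 ℕ.* c))
  k = 4 ℕ.+ 4 ℕ.* c
  e = 3 ℕ.* m ℕ.+ 2 ℕ.* suc c
  S = summand a (suc c)
  exponent-split : ∀ a c → suc (suc (a ℕ.+ 2 ℕ.* c)) ℕ.+ 2 ℕ.* suc c ≡ 4 ℕ.+ 4 ℕ.* c ℕ.+ a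
  exponent-split = ℕSolver.solve-∀
  exponent-outer : ∀ a c → 4 ℕ.* a ℕ.+ 8 ℕ.* suc c ≡ 4 ℕ.* suc (suc (a ℕ.+ 2 ℕ.* c))
  exponent-outer = ℕSolver.solve-∀
  exponent-inner : ∀ a c → 4 ℕ.+ 4 ℕ.* c ℕ.+ (3 ℕ.* suc a ℕ.+ 4 ℕ.* suc c) ≡
                           3 ℕ.* suc (suc (suc a ℕ.+ 2 ℕ.* c)) ℕ.+ 2 ℕ.* suc c
  exponent-inner = ℕSolver.solve-∀
  index : ∀ a c → suc (suc a ℕ.+ 2 ℕ.* c) ≡ a ℕ.+ 2 ℕ.* suc c
  index = ℕSolver.solve-∀
  inner : ∀ a′ → a′ ≡ a → shift k (S -ₚ shift a′ S) ≗ shift e (term (suc (a ℕ.+ 2 ℕ.* c)) (suc c))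
  inner zero refl = ≗-trans (shift-zero k (λ n → ℤP.+-inverseʳ (S n)))
    (≗-sym (shift-zero e (term-vanish (suc c) (subst (suc (2 ℕ.* c) <_) (sym (ℕP.*-suc 2 c)) ℕP.≤-refl))))
  inner (suc a′) refl = begin
    shift k (S -ₚ shift (suc a′) S)
      ≈⟨ shift-cong k (summand-suc₁ a′ (suc c)) ⟩
    shift k (shift (3 ℕ.* suc a′ ℕ.+ 4 ℕ.* suc c) (summand a′ (suc c)))
      ≈⟨ ≗-trans (shift-shift k _ (summand a′ (suc c))) (shift-cong-≡ _ (exponent-inner a′ c)) ⟩
    shift e (summand a′ (suc c))
      ≈⟨ ≗-sym (shift-cong e (term-summand a′ (suc c) (index a′ c))) ⟩
    shift e (term (suc (a ℕ.+ 2 ℕ.* c)) (suc c)) ∎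

term-defect-suc : ∀ M′ c → let m = suc (suc M′) in
  term m (suc c) -ₚ shift (m ℕ.+ 2 ℕ.* suc c) (term m (suc c))
  ≗ shift (4 ℕ.* m) (term M′ c) +ₚ shift (3 ℕ.* m ℕ.+ 2 ℕ.* suc c) (term (suc M′) (suc c))
term-defect-suc M′ c with term-view M′ c
... | inj₁ (a , refl) = begin
  term m b -ₚ shift (m ℕ.+ 2 ℕ.* b) (term m b)
    ≈⟨ -ₚ-cong (term-summand a b (index a c)) (shift-cong (m ℕ.+ 2 ℕ.* b) (term-summand a b (index a c))) ⟩
  summand a b -ₚ shift (m ℕ.+ 2 ℕ.* b) (summand a b)
    ≈⟨ summand-defect-suc a c ⟩
  shift (4 ℕ.* m) (summand a c) +ₚ shift e (term (suc M′) b)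
    ≈⟨ +ₚ-cong (≗-sym (shift-cong (4 ℕ.* m) (term-summand a c refl))) ≗-refl ⟩
  shift (4 ℕ.* m) (term M′ c) +ₚ shift e (term (suc M′) b) ∎
  where
  open ≗-Reasoning
  m = suc (suc M′)
  b = suc c
  e = 3 ℕ.* m ℕ.+ 2 ℕ.* b
  index : ∀ a c → suc (suc (a ℕ.+ 2 ℕ.* c)) ≡ a ℕ.+ 2 ℕ.* suc c
  index = ℕSolver.solve-∀
... | inj₂ M′<2c = ≗-trans
  (-ₚ-cong (term-vanish b m<2b) (shift-zero (m ℕ.+ 2 ℕ.* b) (term-vanish b m<2b)))
  (≗-sym (+ₚ-cong (shift-zero (4 ℕ.* m) (term-vanish c M′<2c))
                  (shift-zero (3 ℕ.* m ℕ.+ 2 ℕ.* b) (term-vanish b (ℕP.<-trans (ℕP.n<1+n (suc M′)) m<2b)))))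
  where
  m = suc (suc M′)
  b = suc c
  m<2b : m < 2 ℕ.* b
  m<2b = subst (m <_) (sym (ℕP.*-suc 2 c)) (s≤s (s≤s M′<2c))

defect : ℕ → PS
defect m = Σₚ m (λ b → term m b -ₚ shift (m ℕ.+ 2 ℕ.* b) (term m b))

crossSum : ℕ → PS
crossSum M = Σₚ (suc M) (λ b → shift (3 ℕ.* suc M ℕ.+ 2 ℕ.* b) (term M b))

H-before : ℕ → PS
H-before zero    = 0ₚ
H-before (suc M) = shift (4 ℕ.* suc (suc M)) (H M)

defect-suc : ∀ M → defect (suc M) ≗ H-before M +ₚ crossSum M
defect-suc zero n = begin
  defect 1 n
    ≡⟨ sumTo-unfoldˡ 0 (λ b → (term 1 b -ₚ shift (1 ℕ.+ 2 ℕ.* b) (term 1 b)) n) ⟩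
  (term 1 0 n - shift (1 ℕ.+ 0) (term 1 0) n) + (term 1 1 n - shift 3 (term 1 1) n)
    ≡⟨ cong₂ _+_ (term-defect-0 0 n) (-ₚ-cong (term-beyond 1 ℕP.≤-refl) (shift-zero 3 (term-beyond 1 ℕP.≤-refl)) n) ⟩
  shift 3 (term 0 0) n + + 0
    ≡⟨ cong (_+_ (shift 3 (term 0 0) n)) (sym (shift-zero 5 (term-beyond 1 ℕP.≤-refl) n)) ⟩
  crossSum 0 n
    ≡⟨ sym (ℤP.+-identityˡ _) ⟩
  (H-before 0 +ₚ crossSum 0) n ∎
  where open ≡-Reasoning
defect-suc (suc M′) n = begin
  defect m n
    ≡⟨ sumTo-unfoldˡ M D ⟩
  D 0 + sumTo M (D ∘ suc)
    ≡⟨ cong₂ _+_ (term-defect-0 M n) (sumTo-cong M (λ c → term-defect-suc M′ c n)) ⟩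
  C 0 + sumTo M (λ c → shift (4 ℕ.* m) (term M′ c) n + C (suc c))
    ≡⟨ cong (_+_ (C 0)) (sumTo-+ M _ _) ⟩
  C 0 + (sumTo M (λ c → shift (4 ℕ.* m) (term M′ c) n) + sumTo M (C ∘ suc))
    ≡⟨ cong (λ x → C 0 + (x + sumTo M (C ∘ suc))) lower ⟩
  C 0 + (H-before M n + sumTo M (C ∘ suc))
    ≡⟨ swap (C 0) (H-before M n) _ ⟩
  H-before M n + (C 0 + sumTo M (C ∘ suc))
    ≡⟨ cong (_+_ (H-before M n)) (sym (sumTo-unfoldˡ M C)) ⟩
  (H-before M +ₚ crossSum M) n ∎
  where
  open ≡-Reasoning
  M = suc M′
  m = suc M
  D : ℕ → ℤ
  D b = term m b n - shift (m ℕ.+ 2 ℕ.* b) (term m b) n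
  C : ℕ → ℤ
  C b = shift (3 ℕ.* m ℕ.+ 2 ℕ.* b) (term M b) n
  lower : sumTo M (λ c → shift (4 ℕ.* m) (term M′ c) n) ≡ H-before M n
  lower = trans (sym (shift-Σₚ (4 ℕ.* m) M (term M′) n))
                (shift-cong (4 ℕ.* m) (H-extend M′ M (ℕP.n≤1+n M′)) n)
  swap : ∀ x y z → x + (y + z) ≡ y + (x + z)
  swap = solve-∀

shift-defect : ∀ M → let k = 2 ℕ.* suc M ℕ.+ 1 in shift k (defect M) ≗ shift k (H M) -ₚ crossSum M
shift-defect M n = begin
  shift k (defect M) n
    ≡⟨ shift-Σₚ k M _ n ⟩
  sumTo M (λ b → shift k (term M b -ₚ shift (M ℕ.+ 2 ℕ.* b) (term M b)) n)
    ≡⟨ sumTo-cong M shift-summand ⟩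
  sumTo M (λ b → shift k (term M b) n - C b)
    ≡⟨ sumTo-minus M _ C ⟩
  sumTo M (λ b → shift k (term M b) n) - sumTo M C
    ≡⟨ cong₂ _-_ (sym (shift-Σₚ k M (term M) n))
                 (sym (sumTo-extend M (suc M) C (ℕP.n≤1+n M) (λ b M<b → shift-zero (e b) (term-beyond b M<b) n))) ⟩
  (shift k (H M) -ₚ crossSum M) n ∎
  where
  open ≡-Reasoning
  k = 2 ℕ.* suc M ℕ.+ 1
  e : ℕ → ℕ
  e b = 3 ℕ.* suc M ℕ.+ 2 ℕ.* b
  C : ℕ → ℤ
  C b = shift (e b) (term M b) n
  exponent-sum : ∀ M b → 2 ℕ.* suc M ℕ.+ 1 ℕ.+ (M ℕ.+ 2 ℕ.* b) ≡ 3 ℕ.* suc M ℕ.+ 2 ℕ.* b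
  exponent-sum = ℕSolver.solve-∀
  shift-summand : ∀ b → shift k (term M b -ₚ shift (M ℕ.+ 2 ℕ.* b) (term M b)) n ≡ shift k (term M b) n - C b
  shift-summand b = trans (shift-minusₚ k _ _ n)
    (cong (_-_ (shift k (term M b) n)) (trans (shift-shift k _ _ n) (shift-cong-≡ (term M b) (exponent-sum M b) n)))

-- Telescoping: defect (M + 1) and q^(2M+3) defect M differ by the same crossSum M.
defect-suc-closed : ∀ M → defect (suc M) ≗ shift (2 ℕ.* suc M ℕ.+ 1) (H M)
defect-suc-closed M n = begin
  defect (suc M) n                                ≡⟨ defect-suc M n ⟩
  H-before M n + crossSum M n                     ≡⟨ cong (_+ crossSum M n) (H-before≡shift-defect M) ⟩
  shift k (defect M) n + crossSum M n             ≡⟨ cong (_+ crossSum M n) (shift-defect M n) ⟩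
  shift k (H M) n - crossSum M n + crossSum M n   ≡⟨ cancel (shift k (H M) n) (crossSum M n) ⟩
  shift k (H M) n ∎
  where
  open ≡-Reasoning
  k = 2 ℕ.* suc M ℕ.+ 1
  cancel : ∀ x y → x - y + y ≡ x
  cancel = solve-∀
  H-before≡shift-defect : ∀ M → H-before M n ≡ shift (2 ℕ.* suc M ℕ.+ 1) (defect M) n
  H-before≡shift-defect zero     = sym (shift-zero 3 (λ n → ℤP.+-inverseʳ (term 0 0 n)) n)
  H-before≡shift-defect (suc M′) = sym (begin
    shift k′ (defect (suc M′)) n                       ≡⟨ shift-cong k′ (defect-suc-closed M′) n ⟩
    shift k′ (shift (2 ℕ.* suc M′ ℕ.+ 1) (H M′)) n     ≡⟨ shift-shift k′ _ (H M′) n ⟩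
    shift (k′ ℕ.+ (2 ℕ.* suc M′ ℕ.+ 1)) (H M′) n       ≡⟨ shift-cong-≡ (H M′) (exponent-sum M′) n ⟩
    H-before (suc M′) n ∎)
    where
    k′ = 2 ℕ.* suc (suc M′) ℕ.+ 1
    exponent-sum : ∀ M′ → 2 ℕ.* suc (suc M′) ℕ.+ 1 ℕ.+ (2 ℕ.* suc M′ ℕ.+ 1) ≡ 4 ℕ.* suc (suc M′)
    exponent-sum = ℕSolver.solve-∀

H-suc : ∀ M → let m = suc M in
  H m ≗ shift (2 ℕ.* m) (H m) +ₚ shift (2 ℕ.* m ℕ.+ 1) (H M) +ₚ shift (4 ℕ.* m) (H M)
H-suc M n = begin
  H m n                                               ≡⟨ split (H m n) S ⟩
  S + (H m n - S)                                     ≡⟨ cong₂ _+_ shifted-sum (sym (sumTo-minus m _ _)) ⟩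
  (shift (4 ℕ.* m) (H M) n + shift (2 ℕ.* m) (H m) n) + defect m n
    ≡⟨ cong (_+_ (shift (4 ℕ.* m) (H M) n + shift (2 ℕ.* m) (H m) n)) (defect-suc-closed M n) ⟩
  (shift (4 ℕ.* m) (H M) n + shift (2 ℕ.* m) (H m) n) + shift (2 ℕ.* m ℕ.+ 1) (H M) n
    ≡⟨ regroup (shift (4 ℕ.* m) (H M) n) (shift (2 ℕ.* m) (H m) n) (shift (2 ℕ.* m ℕ.+ 1) (H M) n) ⟩
  shift (2 ℕ.* m) (H m) n + shift (2 ℕ.* m ℕ.+ 1) (H M) n + shift (4 ℕ.* m) (H M) n ∎
  where
  open ≡-Reasoning
  m = suc M
  S = sumTo m (λ b → shift (m ℕ.+ 2 ℕ.* b) (term m b) n)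
  split : ∀ x s → x ≡ s + (x - s)
  split = solve-∀
  regroup : ∀ a b c → (a + b) + c ≡ b + c + a
  regroup = solve-∀
  shifted-sum : S ≡ shift (4 ℕ.* m) (H M) n + shift (2 ℕ.* m) (H m) n
  shifted-sum = begin
    S   ≡⟨ sym (sumTo-cong m (λ b → term-suc-q-difference M b n)) ⟩
    sumTo m (λ b → shift (4 ℕ.* m) (term M b) n + shift (2 ℕ.* m) (term m b) n)
        ≡⟨ sumTo-+ m _ _ ⟩
    Σₚ m (λ b → shift (4 ℕ.* m) (term M b)) n + Σₚ m (λ b → shift (2 ℕ.* m) (term m b)) n
        ≡⟨ cong₂ _+_ (trans (sym (shift-Σₚ (4 ℕ.* m) m (term M) n))
                            (shift-cong (4 ℕ.* m) (H-extend M m (ℕP.n≤1+n M)) n))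
                     (sym (shift-Σₚ (2 ℕ.* m) m (term m) n)) ⟩
    shift (4 ℕ.* m) (H M) n + shift (2 ℕ.* m) (H m) n ∎

when : Bool → PS → PS
when true  f = f
when false f = 0ₚ

when-≡ : ∀ {m n} f → m ≡ n → when (m ≡ᵇ n) f ≗ f
when-≡ {zero}  f refl = λ _ → refl
when-≡ {suc m} f refl = when-≡ {m} f refl

when-≢ : ∀ {m n} f → m ≢ n → when (m ≡ᵇ n) f ≗ 0ₚ
when-≢ {zero}  {zero}  f m≢n = ⊥-elim (m≢n refl)
when-≢ {zero}  {suc n} f m≢n = λ _ → refl
when-≢ {suc m} {zero}  f m≢n = λ _ → refl
when-≢ {suc m} {suc n} f m≢n = when-≢ {m} {n} f (m≢n ∘ cong suc)

xq-≡ : ∀ i j → xq i j i ≡ qpow j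
xq-≡ i j with i ≡ᵇ i | ℕP.≡⇒≡ᵇ i i refl
... | true | _ = refl

xq-≢ : ∀ i j m → i ≢ m → xq i j m ≡ 0ₚ
xq-≢ i j m i≢m with i ≡ᵇ m | ℕP.≡ᵇ⇒≡ i m
... | true  | ≡ᵇ⇒≡ = ⊥-elim (i≢m (≡ᵇ⇒≡ _))
... | false | _     = refl

*ᵦ-constᵦ : ∀ (A : BPS) U m → (A *ᵦ constᵦ U) m ≗ A m *ₚ U
*ᵦ-constᵦ A U m n = trans
  (sumTo-single m m _ ℕP.≤-refl (λ k k≤m k≢m →
    trans (*ₚ-congʳ (A k) (constᵦ-suc (ℕP.m>n⇒m∸n≢0 (ℕP.≤∧≢⇒< k≤m k≢m))) n) (*ₚ-zeroʳ (A k) n)))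
  (*ₚ-congʳ (A m) (λ n′ → cong (λ j → constᵦ U j n′) (ℕP.n∸n≡0 m)) n)
  where
  constᵦ-suc : ∀ {j} → j ≢ 0 → constᵦ U j ≗ 0ₚ
  constᵦ-suc {zero}  j≢0 = ⊥-elim (j≢0 refl)
  constᵦ-suc {suc j} j≢0 = λ _ → refl

xq-*ᵦ-≤ : ∀ i j (B : BPS) m → i ≤ m → (xq i j *ᵦ B) m ≗ shift j (B (m ∸ i))
xq-*ᵦ-≤ i j B m i≤m n = trans
  (sumTo-single m i _ i≤m (λ k _ k≢i →
    trans (cong (λ f → (f *ₚ B (m ∸ k)) n) (xq-≢ i j k (k≢i ∘ sym))) (*ₚ-zeroˡ (B (m ∸ k)) n)))
  (trans (cong (λ f → (f *ₚ B (m ∸ i)) n) (xq-≡ i j)) (qpow-*ₚ j (B (m ∸ i)) n))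

xq-*ᵦ-< : ∀ i j (B : BPS) m → m < i → (xq i j *ᵦ B) m ≗ 0ₚ
xq-*ᵦ-< i j B m m<i n = sumTo-zero m (λ k k≤m →
  trans (cong (λ f → (f *ₚ B (m ∸ k)) n) (xq-≢ i j k (λ i≡k → ℕP.<⇒≱ m<i (subst (_≤ m) (sym i≡k) k≤m))))
        (*ₚ-zeroˡ (B (m ∸ k)) n))

binomial-0 : ∀ e → (xq 0 0 +ᵦ xq 1 e) 0 ≗ oneₚ
binomial-0 e zero    = refl
binomial-0 e (suc _) = refl

binomial-1 : ∀ e → (xq 0 0 +ᵦ xq 1 e) 1 ≗ qpow e
binomial-1 e k = ℤP.+-identityˡ (qpow e k)

binomial-2+ : ∀ e j → (xq 0 0 +ᵦ xq 1 e) (suc (suc j)) ≗ 0ₚ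
binomial-2+ e j _ = refl

rhsTerm-coefficient : ∀ n₁ n₂ m → rhsTerm n₁ n₂ m ≗
  when (2 ℕ.* n₂ ℕ.+ n₁ ≡ᵇ m) (summand n₁ n₂) +ₚ
  when (suc (2 ℕ.* n₂ ℕ.+ n₁) ≡ᵇ m) (shift (4 ℕ.* n₂ ℕ.+ 2 ℕ.* n₁ ℕ.+ 2) (summand n₁ n₂))
rhsTerm-coefficient n₁ n₂ m = ≗-trans (*ᵦ-constᵦ A U m) (by-cases (below-or-above m))
  where
  open ≗-Reasoning
  e = 4 ℕ.* n₂ ℕ.+ 2 ℕ.* n₁ ℕ.+ 2
  d = 2 ℕ.* n₂ ℕ.+ n₁
  Q = exponent n₁ n₂
  U = invₚ (denominator n₁ n₂)
  T = summand n₁ n₂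
  B = xq 0 0 +ᵦ xq 1 e
  A = xq d Q *ᵦ B
  RHS = when (d ≡ᵇ m) T +ₚ when (suc d ≡ᵇ m) (shift e T)
  below-or-above : ∀ m → m < d ⊎ ∃ λ j → m ≡ j ℕ.+ d
  below-or-above m with d ℕ.≤? m
  ... | yes d≤m = inj₂ (m ∸ d , sym (ℕP.m∸n+n≡m d≤m))
  ... | no d≰m  = inj₁ (ℕP.≰⇒> d≰m)
  at : ∀ j → A (j ℕ.+ d) *ₚ U ≗ shift Q (B j *ₚ U)
  at j = begin
    A (j ℕ.+ d) *ₚ U                ≈⟨ *ₚ-congˡ U (xq-*ᵦ-≤ d Q B (j ℕ.+ d) (ℕP.m≤n+m d j)) ⟩
    shift Q (B (j ℕ.+ d ∸ d)) *ₚ U  ≈⟨ *ₚ-congˡ U (shift-cong Q (λ k → cong (λ i → B i k) (ℕP.m+n∸n≡m j d))) ⟩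
    shift Q (B j) *ₚ U              ≈⟨ shift-*ₚ Q (B j) U ⟩
    shift Q (B j *ₚ U) ∎
  by-cases : m < d ⊎ (∃ λ j → m ≡ j ℕ.+ d) → A m *ₚ U ≗ RHS
  by-cases (inj₁ m<d) = begin
    A m *ₚ U    ≈⟨ *ₚ-congˡ U (xq-*ᵦ-< d Q B m m<d) ⟩
    0ₚ *ₚ U     ≈⟨ *ₚ-zeroˡ U ⟩
    0ₚ +ₚ 0ₚ    ≈⟨ ≗-sym (+ₚ-cong (when-≢ T (ℕP.>⇒≢ m<d)) (when-≢ (shift e T) (ℕP.>⇒≢ (ℕP.m<n⇒m<1+n m<d)))) ⟩
    RHS ∎
  by-cases (inj₂ (zero , refl)) = begin
    A d *ₚ U              ≈⟨ at 0 ⟩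
    shift Q (B 0 *ₚ U)    ≈⟨ shift-cong Q (≗-trans (*ₚ-congˡ U (binomial-0 e)) (*ₚ-identityˡ U)) ⟩
    T                     ≈⟨ (λ n → sym (ℤP.+-identityʳ (T n))) ⟩
    T +ₚ 0ₚ               ≈⟨ ≗-sym (+ₚ-cong (when-≡ {d} {d} T refl) (when-≢ (shift e T) (ℕP.>⇒≢ (ℕP.n<1+n d)))) ⟩
    RHS ∎
  by-cases (inj₂ (suc zero , refl)) = begin
    A (suc d) *ₚ U        ≈⟨ at 1 ⟩
    shift Q (B 1 *ₚ U)    ≈⟨ shift-cong Q (≗-trans (*ₚ-congˡ U (binomial-1 e)) (qpow-*ₚ e U)) ⟩
    shift Q (shift e U)   ≈⟨ shift-shift Q e U ⟩
    shift (Q ℕ.+ e) U     ≈⟨ ≗-trans (shift-cong-≡ U (ℕP.+-comm Q e)) (≗-sym (shift-shift e Q U)) ⟩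
    shift e T             ≈⟨ (λ n → sym (ℤP.+-identityˡ (shift e T n))) ⟩
    0ₚ +ₚ shift e T       ≈⟨ ≗-sym (+ₚ-cong (when-≢ T (ℕP.<⇒≢ (ℕP.n<1+n d))) (when-≡ {suc d} {suc d} (shift e T) refl)) ⟩
    RHS ∎
  by-cases (inj₂ (suc (suc j) , refl)) = begin
    A m *ₚ U                         ≈⟨ at (suc (suc j)) ⟩
    shift Q (B (suc (suc j)) *ₚ U)   ≈⟨ shift-zero Q (≗-trans (*ₚ-congˡ U (binomial-2+ e j)) (*ₚ-zeroˡ U)) ⟩
    0ₚ +ₚ 0ₚ                         ≈⟨ ≗-sym (+ₚ-cong (when-≢ T (ℕP.<⇒≢ (s≤s (ℕP.m≤n+m d (suc j)))))
                                                       (when-≢ (shift e T) (ℕP.<⇒≢ (s≤s (s≤s (ℕP.m≤n+m d j)))))) ⟩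
    RHS ∎

Σ-when-term : ∀ m n₂ k (F : ℕ → PS) → (∀ a → m ≡ a ℕ.+ 2 ℕ.* n₂ → F a ≗ shift k (summand a n₂)) →
              ∀ N → m ≤ N → Σₚ N (λ n₁ → when (2 ℕ.* n₂ ℕ.+ n₁ ≡ᵇ m) (F n₁)) ≗ shift k (term m n₂)
Σ-when-term m n₂ k F F≗ N m≤N n with term-view m n₂
... | inj₁ (a , refl) = begin
  Σₚ N (λ n₁ → when (2 ℕ.* n₂ ℕ.+ n₁ ≡ᵇ m) (F n₁)) n
    ≡⟨ sumTo-single N a _ (ℕP.≤-trans (ℕP.m≤m+n a _) m≤N) (λ j _ j≢a → when-≢ (F j) (j≢a ∘ cancel) n) ⟩
  when (2 ℕ.* n₂ ℕ.+ a ≡ᵇ m) (F a) n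
    ≡⟨ when-≡ (F a) (ℕP.+-comm (2 ℕ.* n₂) a) n ⟩
  F a n
    ≡⟨ F≗ a refl n ⟩
  shift k (summand a n₂) n
    ≡⟨ sym (shift-cong k (term-summand a n₂ refl) n) ⟩
  shift k (term m n₂) n ∎
  where
  open ≡-Reasoning
  cancel : ∀ {j} → 2 ℕ.* n₂ ℕ.+ j ≡ m → j ≡ a
  cancel eq = ℕP.+-cancelˡ-≡ (2 ℕ.* n₂) _ a (trans eq (ℕP.+-comm a (2 ℕ.* n₂)))
... | inj₂ m<2n₂ =
  trans (sumTo-zero N (λ j _ → when-≢ (F j) (ℕP.>⇒≢ (ℕP.<-≤-trans m<2n₂ (ℕP.m≤m+n _ j))) n))
        (sym (shift-zero k (term-vanish n₂ m<2n₂) n))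

H-shifted : ℕ → PS
H-shifted zero    = 0ₚ
H-shifted (suc M) = shift (2 ℕ.* suc M) (H M)

rhsCoeff≡H : ∀ n m → rhsCoeff n m ≡ (H m +ₚ H-shifted m) n
rhsCoeff≡H n m = begin
  rhsCoeff n m
    ≡⟨ sumTo-cong m (λ n₁ → trans (sumTo-cong m (λ n₂ → rhsTerm-coefficient n₁ n₂ m n)) (sumTo-+ m _ _)) ⟩
  sumTo m (λ n₁ → sumTo m (I₁ m n₁) + sumTo m (I₂ m n₁))
    ≡⟨ sumTo-+ m _ _ ⟩
  sumTo m (λ n₁ → sumTo m (I₁ m n₁)) + sumTo m (λ n₁ → sumTo m (I₂ m n₁))
    ≡⟨ cong₂ _+_ (trans (sumTo-swap m m (I₁ m)) (sumTo-cong m unshifted-column)) (shifted-part m) ⟩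
  H m n + H-shifted m n ∎
  where
  open ≡-Reasoning
  I₁ : ℕ → ℕ → ℕ → ℤ
  I₁ m n₁ n₂ = when (2 ℕ.* n₂ ℕ.+ n₁ ≡ᵇ m) (summand n₁ n₂) n
  I₂ : ℕ → ℕ → ℕ → ℤ
  I₂ m n₁ n₂ = when (suc (2 ℕ.* n₂ ℕ.+ n₁) ≡ᵇ m) (shift (4 ℕ.* n₂ ℕ.+ 2 ℕ.* n₁ ℕ.+ 2) (summand n₁ n₂)) n
  unshifted-column : ∀ n₂ → sumTo m (λ n₁ → I₁ m n₁ n₂) ≡ term m n₂ n
  unshifted-column n₂ = Σ-when-term m n₂ 0 (λ a → summand a n₂) (λ _ _ _ → refl) m ℕP.≤-refl n
  exponent-eq : ∀ {M} a b → M ≡ a ℕ.+ 2 ℕ.* b → 4 ℕ.* b ℕ.+ 2 ℕ.* a ℕ.+ 2 ≡ 2 ℕ.* suc M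
  exponent-eq a b refl = solve a b
    where
    solve : ∀ a b → 4 ℕ.* b ℕ.+ 2 ℕ.* a ℕ.+ 2 ≡ 2 ℕ.* suc (a ℕ.+ 2 ℕ.* b)
    solve = ℕSolver.solve-∀
  shifted-column : ∀ M n₂ → sumTo (suc M) (λ n₁ → I₂ (suc M) n₁ n₂) ≡ shift (2 ℕ.* suc M) (term M n₂) n
  shifted-column M n₂ = Σ-when-term M n₂ (2 ℕ.* suc M) (λ n₁ → shift (4 ℕ.* n₂ ℕ.+ 2 ℕ.* n₁ ℕ.+ 2) (summand n₁ n₂))
    (λ a M≡ → shift-cong-≡ (summand a n₂) (exponent-eq a n₂ M≡)) (suc M) (ℕP.n≤1+n M) n
  shifted-part : ∀ m → sumTo m (λ n₁ → sumTo m (I₂ m n₁)) ≡ H-shifted m n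
  shifted-part zero    = refl
  shifted-part (suc M) = begin
    sumTo (suc M) (λ n₁ → sumTo (suc M) (I₂ (suc M) n₁))
      ≡⟨ sumTo-swap (suc M) (suc M) (I₂ (suc M)) ⟩
    sumTo (suc M) (λ n₂ → sumTo (suc M) (λ n₁ → I₂ (suc M) n₁ n₂))
      ≡⟨ sumTo-cong (suc M) (shifted-column M) ⟩
    Σₚ (suc M) (λ n₂ → shift (2 ℕ.* suc M) (term M n₂)) n
      ≡⟨ sym (shift-Σₚ (2 ℕ.* suc M) (suc M) (term M) n) ⟩
    shift (2 ℕ.* suc M) (Σₚ (suc M) (term M)) n
      ≡⟨ shift-cong (2 ℕ.* suc M) (H-extend M (suc M) (ℕP.n≤1+n M)) n ⟩
    H-shifted (suc M) n ∎

≤⇒≤ᵇ≡true : ∀ {m n} → m ≤ n → (m ≤ᵇ n) ≡ true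
≤⇒≤ᵇ≡true m≤n = Equivalence.to BoolP.T-≡ (ℕP.≤⇒≤ᵇ m≤n)

≤ᵇ≡true⇒≤ : ∀ m n → (m ≤ᵇ n) ≡ true → m ≤ n
≤ᵇ≡true⇒≤ m n m≤ᵇn = ℕP.≤ᵇ⇒≤ m n (Equivalence.from BoolP.T-≡ m≤ᵇn)

>⇒≤ᵇ≡false : ∀ {m n} → n < m → (m ≤ᵇ n) ≡ false
>⇒≤ᵇ≡false {m} {n} n<m with m ≤ᵇ n in m≤ᵇn
... | true  = ⊥-elim (ℕP.<⇒≱ n<m (≤ᵇ≡true⇒≤ m n m≤ᵇn))
... | false = refl

suc-≤ᵇ-suc : ∀ m n → (suc m ≤ᵇ suc n) ≡ (m ≤ᵇ n)
suc-≤ᵇ-suc zero    n = refl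
suc-≤ᵇ-suc (suc m) n = refl

+-≡ᵇ : ∀ a x s → (a ℕ.+ x ≡ᵇ s) ≡ (a ≤ᵇ s) ∧ (x ≡ᵇ s ∸ a)
+-≡ᵇ zero    x s       = refl
+-≡ᵇ (suc a) x zero    = refl
+-≡ᵇ (suc a) x (suc s) rewrite suc-≤ᵇ-suc a s = +-≡ᵇ a x s

-- The least part that may follow a part a.
next : ℕ → ℕ
next a = if odd a then a ℕ.+ 2 else a ℕ.+ 3

odd-2+ : ∀ a → odd (2 ℕ.+ a) ≡ odd a
odd-2+ a = cong (_≡ᵇ 1) (trans (cong (ℕ._% 2) (ℕP.+-comm 2 a)) (ℕDM.[m+n]%n≡m%n a 2))

next-2+ : ∀ a → next (2 ℕ.+ a) ≡ 2 ℕ.+ next a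
next-2+ a rewrite odd-2+ a with odd a
... | true  = ℕP.+-assoc 2 a 2
... | false = ℕP.+-assoc 2 a 3

a+2≤next : ∀ a → a ℕ.+ 2 ≤ next a
a+2≤next a with odd a
... | true  = ℕP.≤-refl
... | false = ℕP.+-monoʳ-≤ a (ℕP.n≤1+n 2)

1≤next : ∀ a → 1 ≤ next a
1≤next a = ℕP.≤-trans (ℕP.≤-trans (s≤s z≤n) (ℕP.m≤n+m 2 a)) (a+2≤next a)

gapOK≡next≤ᵇ : ∀ a b → gapOK a b ≡ (next a ≤ᵇ b)
gapOK≡next≤ᵇ a b with odd a in odd-a
... | false = ∧-by-right (a ℕ.+ 2 ≤ᵇ b) (a ℕ.+ 3 ≤ᵇ b)
                (λ a+3≤ᵇb → ≤⇒≤ᵇ≡true (ℕP.≤-trans (ℕP.n≤1+n _)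
                                         (subst (_≤ b) (ℕP.+-suc a 2) (≤ᵇ≡true⇒≤ _ b a+3≤ᵇb))))
  where
  ∧-by-right : ∀ x y → (y ≡ true → x ≡ true) → x ∧ y ≡ y
  ∧-by-right true  y     _   = refl
  ∧-by-right false true  y⇒x with () ← y⇒x refl
  ∧-by-right false false _   = refl
... | true with a ℕ.+ 2 ≤ᵇ b in a+2≤ᵇb
...   | false = refl
...   | true with ℕP.m≤n⇒m<n∨m≡n (≤ᵇ≡true⇒≤ (a ℕ.+ 2) b a+2≤ᵇb)
...     | inj₂ refl = cong (_∨ (a ℕ.+ 3 ≤ᵇ a ℕ.+ 2)) (trans (cong odd (ℕP.+-comm a 2)) (trans (odd-2+ a) odd-a))
...     | inj₁ a+2<b =
  trans (cong (odd b ∨_) (≤⇒≤ᵇ≡true (subst (_≤ b) (sym (ℕP.+-suc a 2)) a+2<b))) (BoolP.∨-zeroʳ (odd b))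

gapsOK⇒sortedB : ∀ l → gapsOK l ≡ true → sortedB l ≡ true
gapsOK⇒sortedB []          _  = refl
gapsOK⇒sortedB (a ∷ [])    _  = refl
gapsOK⇒sortedB (a ∷ b ∷ l) ok = cong₂ _∧_
  (≤⇒≤ᵇ≡true (ℕP.≤-trans (ℕP.m≤m+n a 2)
    (≤ᵇ≡true⇒≤ (a ℕ.+ 2) b (BoolP.∧-conicalˡ _ _ (BoolP.∧-conicalˡ _ _ ok)))))
  (gapsOK⇒sortedB (b ∷ l) (BoolP.∧-conicalʳ _ _ ok))

admissible : ℕ → ℕ → List ℕ → Bool
admissible a₀ s []      = 0 ≡ᵇ s
admissible a₀ s (a ∷ l) = (a₀ ≤ᵇ a) ∧ ((a ≤ᵇ s) ∧ admissible (next a) (s ∸ a) l)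

startsAbove : ℕ → List ℕ → Bool
startsAbove a₀ []      = true
startsAbove a₀ (a ∷ _) = a₀ ≤ᵇ a

gapsOK-∷ : ∀ a l → gapsOK (a ∷ l) ≡ startsAbove (next a) l ∧ gapsOK l
gapsOK-∷ a []      = refl
gapsOK-∷ a (b ∷ l) = cong (_∧ gapsOK (b ∷ l)) (gapOK≡next≤ᵇ a b)

admissible-spec : ∀ a₀ s l → (listSum l ≡ᵇ s) ∧ (startsAbove a₀ l ∧ gapsOK l) ≡ admissible a₀ s l
admissible-spec a₀ s []      = BoolP.∧-identityʳ (0 ≡ᵇ s)
admissible-spec a₀ s (a ∷ l) rewrite +-≡ᵇ a (listSum l) s | gapsOK-∷ a l
                                   | sym (admissible-spec (next a) (s ∸ a) l) =
  interchange (a ≤ᵇ s) (listSum l ≡ᵇ s ∸ a) (a₀ ≤ᵇ a) (startsAbove (next a) l ∧ gapsOK l)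
  where
  interchange : ∀ x y z w → (x ∧ y) ∧ (z ∧ w) ≡ z ∧ (x ∧ (y ∧ w))
  interchange true  true  z w = refl
  interchange true  false true  w = refl
  interchange true  false false w = refl
  interchange false y     true  w = refl
  interchange false y     false w = refl

isD21≡admissible : ∀ n l → isD21 n l ≡ admissible 2 n l
isD21≡admissible n l = begin
  (listSum l ≡ᵇ n) ∧ (sortedB l ∧ (smallestOK l ∧ gapsOK l))
    ≡⟨ cong ((listSum l ≡ᵇ n) ∧_) (drop-sorted (sortedB l) (smallestOK l) (gapsOK l) (gapsOK⇒sortedB l)) ⟩
  (listSum l ≡ᵇ n) ∧ (smallestOK l ∧ gapsOK l)
    ≡⟨ cong (λ x → (listSum l ≡ᵇ n) ∧ (x ∧ gapsOK l)) (smallestOK≡startsAbove l) ⟩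
  (listSum l ≡ᵇ n) ∧ (startsAbove 2 l ∧ gapsOK l)
    ≡⟨ admissible-spec 2 n l ⟩
  admissible 2 n l ∎
  where
  open ≡-Reasoning
  smallestOK≡startsAbove : ∀ l → smallestOK l ≡ startsAbove 2 l
  smallestOK≡startsAbove []      = refl
  smallestOK≡startsAbove (_ ∷ _) = refl
  drop-sorted : ∀ x y z → (z ≡ true → x ≡ true) → x ∧ (y ∧ z) ≡ y ∧ z
  drop-sorted true  y     z     _   = refl
  drop-sorted false y     true  z⇒x with () ← z⇒x refl
  drop-sorted false true  false _   = refl
  drop-sorted false false false _   = refl

boolToℕ : Bool → ℕ
boolToℕ true  = 1
boolToℕ false = 0

count : (List ℕ → Bool) → List (List ℕ) → ℕ
count P L = List.length (List.filter (λ l → isTrue? (P l)) L)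

count-∷ : ∀ P l L → count P (l ∷ L) ≡ boolToℕ (P l) ℕ.+ count P L
count-∷ P l L with P l
... | true  = refl
... | false = refl

count-++ : ∀ P L L′ → count P (L ++ L′) ≡ count P L ℕ.+ count P L′
count-++ P []      L′ = refl
count-++ P (l ∷ L) L′ rewrite count-∷ P l (L ++ L′) | count-∷ P l L | count-++ P L L′ =
  sym (ℕP.+-assoc (boolToℕ (P l)) _ _)

count-map-∷ : ∀ P a L → count P (map (a ∷_) L) ≡ count (P ∘ (a ∷_)) L
count-map-∷ P a []      = refl
count-map-∷ P a (l ∷ L)
  rewrite count-∷ P (a ∷ l) (map (a ∷_) L) | count-∷ (P ∘ (a ∷_)) l L | count-map-∷ P a L = refl

count-cong : ∀ {P P′} L → (∀ l → P l ≡ P′ l) → count P L ≡ count P′ L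
count-cong {P} {P′} []      P≡P′ = refl
count-cong {P} {P′} (l ∷ L) P≡P′
  rewrite count-∷ P l L | count-∷ P′ l L | P≡P′ l | count-cong L P≡P′ = refl

count-∧ˡ : ∀ b P L → count (λ l → b ∧ P l) L ≡ boolToℕ b ℕ.* count P L
count-∧ˡ true  P L = sym (ℕP.+-identityʳ _)
count-∧ˡ false P L = none L
  where
  none : ∀ L → count (λ _ → false) L ≡ 0
  none []      = refl
  none (_ ∷ L) = none L

count-concatMap : ∀ P (G : ℕ → List (List ℕ)) as → count P (concatMap G as) ≡ sum (map (count P ∘ G) as)
count-concatMap P G []       = refl
count-concatMap P G (a ∷ as) =
  trans (count-++ P (G a) (concatMap G as)) (cong (count P (G a) ℕ.+_) (count-concatMap P G as))

sumFrom : ℕ → ℕ → (ℕ → ℕ) → ℕ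
sumFrom b zero    F = 0
sumFrom b (suc k) F = F b ℕ.+ sumFrom (suc b) k F

sum-map-applyUpTo : ∀ F k b (f : ℕ → ℕ) → (∀ i → f i ≡ b ℕ.+ i) →
                    sum (map F (applyUpTo f k)) ≡ sumFrom b k F
sum-map-applyUpTo F zero    b f f≗b+ = refl
sum-map-applyUpTo F (suc k) b f f≗b+ = cong₂ ℕ._+_ (cong F (trans (f≗b+ 0) (ℕP.+-identityʳ b)))
  (sum-map-applyUpTo F k (suc b) (f ∘ suc) (λ i → trans (f≗b+ (suc i)) (ℕP.+-suc b i)))

sumFrom-zero : ∀ k b F → (∀ i → b ≤ i → F i ≡ 0) → sumFrom b k F ≡ 0
sumFrom-zero zero    b F F≡0 = refl
sumFrom-zero (suc k) b F F≡0 =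
  cong₂ ℕ._+_ (F≡0 b ℕP.≤-refl) (sumFrom-zero k (suc b) F (λ i b<i → F≡0 i (ℕP.<⇒≤ b<i)))

module Restrict (a₀ s : ℕ) (G : ℕ → ℕ) where

  restricted : ℕ → ℕ
  restricted a = boolToℕ (a₀ ≤ᵇ a) ℕ.* (boolToℕ (a ≤ᵇ s) ℕ.* G a)

  sumFrom-from-a₀ : ∀ k b → a₀ ≤ b → s < b ℕ.+ k → sumFrom b k restricted ≡ sumFrom b (suc s ∸ b) G
  sumFrom-from-a₀ zero b a₀≤b s<b+0 rewrite ℕP.m≤n⇒m∸n≡0 (subst (suc s ≤_) (ℕP.+-identityʳ b) s<b+0) = refl
  sumFrom-from-a₀ (suc k) b a₀≤b s<b+k with b ℕ.≤? s
  ... | yes b≤s rewrite ℕP.+-∸-assoc 1 b≤s | ≤⇒≤ᵇ≡true a₀≤b | ≤⇒≤ᵇ≡true b≤s =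
    cong₂ ℕ._+_ (trans (ℕP.+-identityʳ _) (ℕP.+-identityʳ _))
                (sumFrom-from-a₀ k (suc b) (ℕP.m≤n⇒m≤1+n a₀≤b) (subst (s <_) (ℕP.+-suc b k) s<b+k))
  ... | no b≰s rewrite ℕP.m≤n⇒m∸n≡0 (ℕP.≰⇒> b≰s) =
    sumFrom-zero (suc k) b restricted (λ i b≤i →
      trans (cong (λ x → boolToℕ (a₀ ≤ᵇ i) ℕ.* (boolToℕ x ℕ.* G i))
                  (>⇒≤ᵇ≡false (ℕP.<-≤-trans (ℕP.≰⇒> b≰s) b≤i)))
            (ℕP.*-zeroʳ (boolToℕ (a₀ ≤ᵇ i))))

  sumFrom-restrict : ∀ k b → b ≤ a₀ → s < b ℕ.+ k → sumFrom b k restricted ≡ sumFrom a₀ (suc s ∸ a₀) G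
  sumFrom-restrict k b b≤a₀ s<b+k with ℕP.m≤n⇒m<n∨m≡n b≤a₀
  ... | inj₂ refl = sumFrom-from-a₀ k b ℕP.≤-refl s<b+k
  sumFrom-restrict zero b b≤a₀ s<b+0 | inj₁ b<a₀
    rewrite ℕP.m≤n⇒m∸n≡0 (ℕP.≤-trans (subst (suc s ≤_) (ℕP.+-identityʳ b) s<b+0) (ℕP.<⇒≤ b<a₀)) = refl
  sumFrom-restrict (suc k) b b≤a₀ s<b+k | inj₁ b<a₀ rewrite >⇒≤ᵇ≡false b<a₀ =
    sumFrom-restrict k (suc b) b<a₀ (subst (s <_) (ℕP.+-suc b k) s<b+k)

admissibleCount : ℕ → ℕ → ℕ → ℕ
admissibleCount a₀ s zero    = boolToℕ (0 ≡ᵇ s)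
admissibleCount a₀ s (suc m) = sumFrom a₀ (suc s ∸ a₀) (λ a → admissibleCount (next a) (s ∸ a) m)

-- Lists with entries in {1, …, N} include every admissible list of sum s ≤ N.
count-candidates : ∀ m N a₀ s → 1 ≤ a₀ → s ≤ N →
                   count (admissible a₀ s) (candidates N m) ≡ admissibleCount a₀ s m
count-candidates zero    N a₀ s 1≤a₀ s≤N = trans (count-∷ (admissible a₀ s) [] []) (ℕP.+-identityʳ _)
count-candidates (suc m) N a₀ s 1≤a₀ s≤N = begin
  count (admissible a₀ s) (concatMap (λ a → map (a ∷_) (candidates N m)) (map suc (upTo N)))
    ≡⟨ count-concatMap (admissible a₀ s) (λ a → map (a ∷_) (candidates N m)) (map suc (upTo N)) ⟩
  sum (map (λ a → count (admissible a₀ s) (map (a ∷_) (candidates N m))) (map suc (upTo N)))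
    ≡⟨ cong sum (ListP.map-cong first-part (map suc (upTo N))) ⟩
  sum (map restricted (map suc (upTo N)))
    ≡⟨ cong (sum ∘ map restricted) (ListP.map-upTo suc N) ⟩
  sum (map restricted (applyUpTo suc N))
    ≡⟨ sum-map-applyUpTo restricted N 1 suc (λ _ → refl) ⟩
  sumFrom 1 N restricted
    ≡⟨ sumFrom-restrict N 1 1≤a₀ (s≤s s≤N) ⟩
  admissibleCount a₀ s (suc m) ∎
  where
  open ≡-Reasoning
  open Restrict a₀ s (λ a → admissibleCount (next a) (s ∸ a) m)
  first-part : ∀ a → count (admissible a₀ s) (map (a ∷_) (candidates N m)) ≡ restricted a
  first-part a = begin
    count (admissible a₀ s) (map (a ∷_) (candidates N m))
      ≡⟨ count-map-∷ (admissible a₀ s) a (candidates N m) ⟩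
    count (λ l → (a₀ ≤ᵇ a) ∧ ((a ≤ᵇ s) ∧ admissible (next a) (s ∸ a) l)) (candidates N m)
      ≡⟨ count-∧ˡ (a₀ ≤ᵇ a) _ (candidates N m) ⟩
    boolToℕ (a₀ ≤ᵇ a) ℕ.* count (λ l → (a ≤ᵇ s) ∧ admissible (next a) (s ∸ a) l) (candidates N m)
      ≡⟨ cong (boolToℕ (a₀ ≤ᵇ a) ℕ.*_) (count-∧ˡ (a ≤ᵇ s) _ (candidates N m)) ⟩
    boolToℕ (a₀ ≤ᵇ a) ℕ.* (boolToℕ (a ≤ᵇ s) ℕ.* count (admissible (next a) (s ∸ a)) (candidates N m))
      ≡⟨ cong (λ x → boolToℕ (a₀ ≤ᵇ a) ℕ.* (boolToℕ (a ≤ᵇ s) ℕ.* x))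
              (count-candidates m N (next a) (s ∸ a) (1≤next a) (ℕP.≤-trans (ℕP.m∸n≤m s a) s≤N)) ⟩
    restricted a ∎

D21≡admissibleCount : ∀ n m → D21 n m ≡ admissibleCount 2 n m
D21≡admissibleCount n m =
  trans (count-cong (candidates n m) (isD21≡admissible n)) (count-candidates m n 2 n (s≤s z≤n) ℕP.≤-refl)

partitions : ℕ → ℕ → PS
partitions a₀ m s = + admissibleCount a₀ s m

partitions-zero : ∀ a₀ → partitions a₀ 0 ≗ oneₚ
partitions-zero a₀ zero    = refl
partitions-zero a₀ (suc s) = refl

-- Either the smallest part exceeds a₀, or it equals a₀ and the rest starts at next a₀.
partitions-suc : ∀ a₀ m →
  partitions a₀ (suc m) ≗ partitions (suc a₀) (suc m) +ₚ shift a₀ (partitions (next a₀) m)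
partitions-suc a₀ m s with a₀ ℕ.≤? s
... | yes a₀≤s rewrite ℕP.+-∸-assoc 1 a₀≤s | shift-≤ a₀ (partitions (next a₀) m) a₀≤s =
  cong +_ (ℕP.+-comm (admissibleCount (next a₀) (s ∸ a₀) m) _)
... | no a₀≰s rewrite ℕP.m≤n⇒m∸n≡0 (ℕP.≰⇒> a₀≰s) | ℕP.m≤n⇒m∸n≡0 (ℕP.<⇒≤ (ℕP.≰⇒> a₀≰s))
                    | shift-< a₀ (partitions (next a₀) m) (ℕP.≰⇒> a₀≰s) = refl

partitions-vanish : ∀ a₀ m {s} → s < a₀ → partitions a₀ (suc m) s ≡ + 0
partitions-vanish a₀ m s<a₀ rewrite ℕP.m≤n⇒m∸n≡0 s<a₀ = refl

-- Adding 2 to every part; the coefficient of q^s is proved by descending induction on a₀ from s.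
partitions-2+ : ∀ m a → partitions (2 ℕ.+ a) m ≗ shift (2 ℕ.* m) (partitions a m)
partitions-2+ zero    a s = refl
partitions-2+ (suc m) a s = below (suc s) a s (subst (s <_) (sym (ℕP.+-suc a s)) (s≤s (ℕP.m≤n+m s a)))
  where
  exponent-eq : ∀ a m → 2 ℕ.+ a ℕ.+ 2 ℕ.* m ≡ 2 ℕ.* suc m ℕ.+ a
  exponent-eq = ℕSolver.solve-∀
  below : ∀ d a s → s < a ℕ.+ d →
          partitions (2 ℕ.+ a) (suc m) s ≡ shift (2 ℕ.* suc m) (partitions a (suc m)) s
  below zero a s s<a+0 = trans (partitions-vanish (2 ℕ.+ a) m (ℕP.m<n⇒m<1+n (ℕP.m<n⇒m<1+n s<a)))
    (sym (shift-vanish (2 ℕ.* suc m) (partitions a (suc m)) s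
                       (λ j j≤s → partitions-vanish a m (ℕP.≤-<-trans j≤s s<a))))
    where
    s<a = subst (s <_) (ℕP.+-identityʳ a) s<a+0
  below (suc d) a s s<a+1+d = begin
    partitions (2 ℕ.+ a) (suc m) s
      ≡⟨ partitions-suc (2 ℕ.+ a) m s ⟩
    partitions (3 ℕ.+ a) (suc m) s + shift (2 ℕ.+ a) (partitions (next (2 ℕ.+ a)) m) s
      ≡⟨ cong₂ _+_ (below d (suc a) s (subst (s <_) (ℕP.+-suc a d) s<a+1+d)) smallest-part ⟩
    shift (2 ℕ.* suc m) (partitions (suc a) (suc m)) s + shift (2 ℕ.* suc m) (shift a (partitions (next a) m)) s
      ≡⟨ sym (shift-+ₚ (2 ℕ.* suc m) _ _ s) ⟩
    shift (2 ℕ.* suc m) (partitions (suc a) (suc m) +ₚ shift a (partitions (next a) m)) s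
      ≡⟨ sym (shift-cong (2 ℕ.* suc m) (partitions-suc a m) s) ⟩
    shift (2 ℕ.* suc m) (partitions a (suc m)) s ∎
    where
    open ≡-Reasoning
    smallest-part : shift (2 ℕ.+ a) (partitions (next (2 ℕ.+ a)) m) s ≡
                    shift (2 ℕ.* suc m) (shift a (partitions (next a) m)) s
    smallest-part = begin
      shift (2 ℕ.+ a) (partitions (next (2 ℕ.+ a)) m) s
        ≡⟨ shift-cong (2 ℕ.+ a) (λ j → cong (λ b → partitions b m j) (next-2+ a)) s ⟩
      shift (2 ℕ.+ a) (partitions (2 ℕ.+ next a) m) s
        ≡⟨ shift-cong (2 ℕ.+ a) (partitions-2+ m (next a)) s ⟩
      shift (2 ℕ.+ a) (shift (2 ℕ.* m) (partitions (next a) m)) s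
        ≡⟨ shift-shift (2 ℕ.+ a) (2 ℕ.* m) _ s ⟩
      shift (2 ℕ.+ a ℕ.+ 2 ℕ.* m) (partitions (next a) m) s
        ≡⟨ shift-cong-≡ _ (exponent-eq a m) s ⟩
      shift (2 ℕ.* suc m ℕ.+ a) (partitions (next a) m) s
        ≡⟨ sym (shift-shift (2 ℕ.* suc m) a _ s) ⟩
      shift (2 ℕ.* suc m) (shift a (partitions (next a) m)) s ∎

partitions-2-suc : ∀ M → partitions 2 (suc M) ≗ partitions 3 (suc M) +ₚ shift (2 ℕ.* suc M) (partitions 3 M)
partitions-2-suc M = begin
  partitions 2 (suc M)                                   ≈⟨ partitions-suc 2 M ⟩
  partitions 3 (suc M) +ₚ shift 2 (partitions 5 M)       ≈⟨ +ₚ-cong {f = partitions 3 (suc M)} ≗-refl shift-5 ⟩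
  partitions 3 (suc M) +ₚ shift (2 ℕ.* suc M) (partitions 3 M) ∎
  where
  open ≗-Reasoning
  exponent-eq : ∀ M → 2 ℕ.+ 2 ℕ.* M ≡ 2 ℕ.* suc M
  exponent-eq = ℕSolver.solve-∀
  shift-5 : shift 2 (partitions 5 M) ≗ shift (2 ℕ.* suc M) (partitions 3 M)
  shift-5 = ≗-trans (shift-cong 2 (partitions-2+ M 3))
                    (≗-trans (shift-shift 2 (2 ℕ.* M) _) (shift-cong-≡ _ (exponent-eq M)))

partitions-3-suc : ∀ M → let m = suc M in
  partitions 3 m ≗
  shift (2 ℕ.* m) (partitions 3 m) +ₚ shift (2 ℕ.* m ℕ.+ 1) (partitions 3 M) +ₚ shift (4 ℕ.* m) (partitions 3 M)
partitions-3-suc M s = begin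
  partitions 3 m s
    ≡⟨ partitions-suc 3 M s ⟩
  partitions 4 m s + shift 3 (partitions 5 M) s
    ≡⟨ cong₂ _+_ (trans (partitions-2+ m 2 s) (shift-cong (2 ℕ.* m) (partitions-2-suc M) s)) shift-3-5 ⟩
  shift (2 ℕ.* m) (P3 m +ₚ shift (2 ℕ.* m) (P3 M)) s + shift (2 ℕ.* m ℕ.+ 1) (P3 M) s
    ≡⟨ cong (_+ shift (2 ℕ.* m ℕ.+ 1) (P3 M) s) (trans (shift-+ₚ (2 ℕ.* m) _ _ s)
         (cong (_+_ (shift (2 ℕ.* m) (P3 m) s))
               (trans (shift-shift (2 ℕ.* m) (2 ℕ.* m) _ s) (shift-cong-≡ _ (exponent-eq₁ M) s)))) ⟩
  shift (2 ℕ.* m) (P3 m) s + shift (4 ℕ.* m) (P3 M) s + shift (2 ℕ.* m ℕ.+ 1) (P3 M) s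
    ≡⟨ swap-last (shift (2 ℕ.* m) (P3 m) s) (shift (4 ℕ.* m) (P3 M) s) (shift (2 ℕ.* m ℕ.+ 1) (P3 M) s) ⟩
  shift (2 ℕ.* m) (P3 m) s + shift (2 ℕ.* m ℕ.+ 1) (P3 M) s + shift (4 ℕ.* m) (P3 M) s ∎
  where
  open ≡-Reasoning
  m = suc M
  P3 = partitions 3
  exponent-eq₁ : ∀ M → 2 ℕ.* suc M ℕ.+ 2 ℕ.* suc M ≡ 4 ℕ.* suc M
  exponent-eq₁ = ℕSolver.solve-∀
  exponent-eq₂ : ∀ M → 3 ℕ.+ 2 ℕ.* M ≡ 2 ℕ.* suc M ℕ.+ 1
  exponent-eq₂ = ℕSolver.solve-∀
  shift-3-5 : shift 3 (partitions 5 M) s ≡ shift (2 ℕ.* m ℕ.+ 1) (P3 M) s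
  shift-3-5 = trans (shift-cong 3 (partitions-2+ M 3) s)
                    (trans (shift-shift 3 (2 ℕ.* M) _ s) (shift-cong-≡ _ (exponent-eq₂ M) s))
  swap-last : ∀ x y z → x + y + z ≡ x + z + y
  swap-last = solve-∀

H≗partitions-3 : ∀ m → H m ≗ partitions 3 m
H≗partitions-3 zero    = ≗-trans H-0 (≗-sym (partitions-zero 3))
H≗partitions-3 (suc M) = q-difference-injective _ (H (suc M)) (partitions 3 (suc M)) (begin
  H m -ₚ shift (2 ℕ.* m) (H m)
    ≈⟨ recurrence⇒q-difference (2 ℕ.* m) (H-suc M) ⟩
  shift (2 ℕ.* m ℕ.+ 1) (H M) +ₚ shift (4 ℕ.* m) (H M)
    ≈⟨ +ₚ-cong (shift-cong (2 ℕ.* m ℕ.+ 1) (H≗partitions-3 M)) (shift-cong (4 ℕ.* m) (H≗partitions-3 M)) ⟩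
  shift (2 ℕ.* m ℕ.+ 1) (partitions 3 M) +ₚ shift (4 ℕ.* m) (partitions 3 M)
    ≈⟨ ≗-sym (recurrence⇒q-difference (2 ℕ.* m) (partitions-3-suc M)) ⟩
  partitions 3 m -ₚ shift (2 ℕ.* m) (partitions 3 m) ∎)
  where
  open ≗-Reasoning
  m = suc M

partitions-2≗H : ∀ m → partitions 2 m ≗ H m +ₚ H-shifted m
partitions-2≗H zero    s = trans (partitions-zero 2 s) (trans (sym (H-0 s)) (sym (ℤP.+-identityʳ _)))
partitions-2≗H (suc M) s = trans (partitions-2-suc M s)
  (sym (cong₂ _+_ (H≗partitions-3 (suc M) s) (shift-cong (2 ℕ.* suc M) (H≗partitions-3 M) s)))

theorem14 : (n m : ℕ) → + (D21 n m) ≡ rhsCoeff n m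
theorem14 n m = begin
  + D21 n m                     ≡⟨ cong +_ (D21≡admissibleCount n m) ⟩
  partitions 2 m n              ≡⟨ partitions-2≗H m n ⟩
  (H m +ₚ H-shifted m) n        ≡⟨ sym (rhsCoeff≡H n m) ⟩
  rhsCoeff n m ∎
  where open ≡-Reasoning
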